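{- Let $G$ be a finite simple graph on $n$ vertices with $m$ edges, with Laplacian matching roots $\lambda_1,\dots,\lambda_n$, and let $p_r(G)=\sum_{i=1}^n\lambda_i^r$. Define $A_r=\sum_{v\in V(G)}d_G(v)^r$, $B=\sum_{xy\in E(G)}d_G(x)d_G(y)$, and $C=\sum_{xy\in E(G)}\bigl(d_G(x)^2d_G(y)+d_G(x)d_G(y)^2\bigr)$. Then \[p_4(G)=A_4+4A_3+2A_2+4B-2m\] and \[p_5(G)=A_5+5A_4+5A_3-5A_2+5C+10B.\]
   Context: For a finite simple graph $G$ with degrees $d_G(v)$, the Laplacian matching polynomial is $\mathscr{LM}_G(x)=\sum_{M}(-1)^{|M|}\prod_{v\in V(G)\setminus V(M)}(x-d_G(v))$, the sum over all matchings $M$ of $G$ (including the empty one), $V(M)$ being the vertices covered by $M$. Its $n$ roots (with multiplicity) are the Laplacian matching roots of $G$. -}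

module Defs where

open import Level using (Level)
open import Data.Bool using (Bool; true; false; if_then_else_; _∧_; _∨_; not)
open import Data.Nat as ℕ using (ℕ; zero; suc; _<ᵇ_)
open import Data.Integer as ℤ using (ℤ; +_; -[1+_])
open import Data.Fin using (Fin; toℕ)
open import Data.Fin.Properties using (_≟_)
open import Data.Product using (_×_; _,_)
open import Data.List using (List; []; _∷_; _++_; map; concatMap; length; filterᵇ; foldr)
open import Data.Bool.ListAction using (all; any)
open import Data.List.Base using (allFin)
open import Relation.Nullary.Decidable using (⌊_⌋)
open import Relation.Binary.PropositionalEquality using (_≡_)
open import Algebra.Bundles using (CommutativeRing)

record Graph (n : ℕ) : Set where
  field
    adj    : Fin n → Fin n → Bool
    sym    : ∀ i j → adj i j ≡ adj j i
    irrefl : ∀ i → adj i i ≡ false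
open Graph public

module _ {n : ℕ} (G : Graph n) where

  deg : Fin n → ℕ
  deg v = foldr ℕ._+_ 0 (map (λ j → if adj G v j then 1 else 0) (allFin n))

  edges : List (Fin n × Fin n)
  edges = concatMap (λ i → concatMap (λ j →
            if (toℕ i <ᵇ toℕ j) ∧ adj G i j then (i , j) ∷ [] else [])
            (allFin n)) (allFin n)

  numEdges : ℕ
  numEdges = length edges

sublists : ∀ {a} {A : Set a} → List A → List (List A)
sublists []       = [] ∷ []
sublists (x ∷ xs) = sublists xs ++ map (x ∷_) (sublists xs)

module _ {n : ℕ} where

  _==_ : Fin n → Fin n → Bool
  i == j = ⌊ i ≟ j ⌋

  shareVertex : Fin n × Fin n → Fin n × Fin n → Bool
  shareVertex (i , j) (k , l) = (i == k) ∨ (i == l) ∨ (j == k) ∨ (j == l)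

  isMatching : List (Fin n × Fin n) → Bool
  isMatching []       = true
  isMatching (e ∷ es) = all (λ f → not (shareVertex e f)) es ∧ isMatching es

  covered : List (Fin n × Fin n) → Fin n → Bool
  covered M v = any (λ e → (v == Data.Product.proj₁ e) ∨ (v == Data.Product.proj₂ e)) M

matchings : ∀ {n} → Graph n → List (List (Fin n × Fin n))
matchings G = filterᵇ isMatching (sublists (edges G))

-- Polynomials as coefficient lists (constant term first), over any
-- carrier with 0, +, *.

module PolyOps {a : Level} {A : Set a} (0# : A) (_+_ _*_ : A → A → A) where

  addP : List A → List A → List A
  addP []       q        = q
  addP (a ∷ p)  []       = a ∷ p
  addP (a ∷ p)  (b ∷ q)  = (a + b) ∷ addP p q

  scaleP : A → List A → List A
  scaleP c = map (c *_)

  mulP : List A → List A → List A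
  mulP []      q = []
  mulP (a ∷ p) q = addP (scaleP a q) (0# ∷ mulP p q)

  coeff : List A → ℕ → A
  coeff []      _       = 0#
  coeff (a ∷ p) zero    = a
  coeff (a ∷ p) (suc k) = coeff p k

open PolyOps (+ 0) ℤ._+_ ℤ._*_ renaming
  (addP to addℤ; mulP to mulℤ; coeff to coeffℤ; scaleP to scaleℤ)

-- The Laplacian matching polynomial with integer coefficients:
--   LM_G(x) = Σ_M (-1)^|M| Π_{v ∉ V(M)} (x - d_G(v))

signℤ : ℕ → ℤ
signℤ zero    = + 1
signℤ (suc k) = ℤ.- signℤ k

laplacianMatchingPoly : ∀ {n} → Graph n → List ℤ
laplacianMatchingPoly {n} G =
  foldr addℤ []
    (map (λ M → scaleℤ (signℤ (length M))
                  (foldr mulℤ (+ 1 ∷ [])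
                     (map (λ v → (ℤ.- (+ deg G v)) ∷ + 1 ∷ [])
                          (filterᵇ (λ v → not (covered M v)) (allFin n)))))
         (matchings G))

powℕ : ℕ → ℕ → ℕ
powℕ x zero    = 1
powℕ x (suc r) = x ℕ.* powℕ x r

sumℕ : List ℕ → ℕ
sumℕ = foldr ℕ._+_ 0

A-stat : ∀ {n} → Graph n → ℕ → ℕ
A-stat {n} G r = sumℕ (map (λ v → powℕ (deg G v) r) (allFin n))

B-stat : ∀ {n} → Graph n → ℕ
B-stat G = sumℕ (map (λ e → deg G (Data.Product.proj₁ e) ℕ.* deg G (Data.Product.proj₂ e)) (edges G))

C-stat : ∀ {n} → Graph n → ℕ
C-stat G = sumℕ (map (λ e → cterm (deg G (Data.Product.proj₁ e)) (deg G (Data.Product.proj₂ e))) (edges G))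
  where
  cterm : ℕ → ℕ → ℕ
  cterm x y = x ℕ.* x ℕ.* y ℕ.+ x ℕ.* y ℕ.* y

module InRing {c ℓ : Level} (R : CommutativeRing c ℓ) where
  open CommutativeRing R

  open PolyOps 0# _+_ _*_ public renaming
    (addP to addR; mulP to mulR; coeff to coeffR; scaleP to scaleR)

  fromℕ : ℕ → Carrier
  fromℕ zero    = 0#
  fromℕ (suc k) = 1# + fromℕ k

  fromℤ : ℤ → Carrier
  fromℤ (+ k)      = fromℕ k
  fromℤ -[1+ k ]   = - fromℕ (suc k)

  powR : Carrier → ℕ → Carrier
  powR x zero    = 1#
  powR x (suc r) = x * powR x r

  rootPoly : ∀ {n} → (Fin n → Carrier) → List Carrier
  rootPoly {n} λs = foldr mulR (1# ∷ []) (map (λ i → (- λs i) ∷ 1# ∷ []) (allFin n))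

  -- λ_1..λ_n are the roots (with multiplicity) of the integer polynomial p:
  -- p = Π_i (x - λ_i) coefficientwise in R
  AreRootsOf : ∀ {n} → List ℤ → (Fin n → Carrier) → Set ℓ
  AreRootsOf p λs = ∀ k → coeffR (rootPoly λs) k ≈ fromℤ (coeffℤ p k)

  powerSum : ∀ {n} → (Fin n → Carrier) → ℕ → Carrier
  powerSum {n} λs r = foldr _+_ 0# (map (λ i → powR (λs i) r) (allFin n))

module Submission where

-- A monic polynomial Π (X - λᵢ) of degree n has reversal tⁿ p(1/t) = Π (1 - λᵢ t). Modulo t⁶,
-- Newton's identities read Σ λᵢ⁴ and Σ λᵢ⁵ off the first coefficients of such a series, and they
-- turn products of series with constant term 1 into sums. The reversal of the Laplacian matching
-- polynomial factors as Π_v (1 - d_v t) · Σ_M Π_{xy ∈ M} w_xy with w_xy = -t² / ((1 - d_x t)(1 - d_y t)).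
-- The first factor contributes A₄ and A₅; since every w_xy is a multiple of t², only matchings with
-- at most two edges survive modulo t⁶, and these are counted with the handshake lemma and the fact
-- that d_x + d_y - 1 edges meet an edge xy. Everything is computed over ℤ and carried to R along ℤ → R.

open import Defs hiding (sym)
open import Level using (Level)
open import Function using (id; _∘_)
open import Function.Bundles using (Equivalence)
open import Data.Unit using (tt)
open import Data.Bool using (Bool; true; false; if_then_else_; T; T?; _∧_; _∨_; not)
import Data.Bool.Properties as Bool
open import Data.Bool.ListAction using (all)
open import Data.Maybe using (Maybe; just; nothing)
open import Data.Product using (_×_; _,_; proj₁; proj₂)
open import Data.Nat as ℕ using (ℕ; zero; suc; s≤s)
import Data.Nat.Properties as ℕ
open import Data.Integer as ℤ using (ℤ; +_; -[1+_])
import Data.Integer.Properties as ℤ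
open import Data.Fin using (Fin; #_; combine; toℕ; _↑ˡ_; _↑ʳ_)
import Data.Fin.Properties
open import Data.Vec as Vec using (Vec; []; _∷_; concat; tabulate)
open import Data.List as List using (List; []; _∷_; _++_; foldr; concatMap; filterᵇ)
import Data.List.Properties as List
open import Data.List.Relation.Unary.All as All using (All; []; _∷_)
import Data.List.Relation.Unary.All.Properties as All
open import Relation.Nullary using (yes; no; contradiction)
open import Relation.Binary.Definitions using (tri<; tri≈; tri>)
open import Relation.Binary.PropositionalEquality as ≡ using (_≡_; _≢_)
open import Algebra.Bundles using (CommutativeRing; RawRing)
open import Algebra.Structures using (IsCommutativeRing)
open import Algebra.Solver.Ring.AlmostCommutativeRing using (fromCommutativeRing; _-Raw-AlmostCommutative⟶_)
import Algebra.Solver.Ring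

ℤ-ring : CommutativeRing _ _
ℤ-ring = ℤ.+-*-commutativeRing

module IntegerImage {c ℓ : Level} (R : CommutativeRing c ℓ) where
  open CommutativeRing R
  open InRing R using (fromℕ; fromℤ)
  open import Algebra.Properties.Semiring.Mult semiring using (×-homo-+; ×1-homo-*) renaming (_×_ to _·_)
  open import Algebra.Properties.Ring ring
    using (-0#≈0#; -‿involutive; -‿distribˡ-*; -‿distribʳ-*; -‿anti-homo-+)
  open import Relation.Binary.Reasoning.Setoid setoid

  fromℕ≡·1 : ∀ k → fromℕ k ≡ k · 1#
  fromℕ≡·1 zero    = ≡.refl
  fromℕ≡·1 (suc k) = ≡.cong (λ x → 1# + x) (fromℕ≡·1 k)

  fromℕ-homo-+ : ∀ m n → fromℕ (m ℕ.+ n) ≈ fromℕ m + fromℕ n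
  fromℕ-homo-+ m n = begin
    fromℕ (m ℕ.+ n)     ≡⟨ fromℕ≡·1 (m ℕ.+ n) ⟩
    (m ℕ.+ n) · 1#      ≈⟨ ×-homo-+ 1# m n ⟩
    m · 1# + n · 1#     ≡⟨ ≡.cong₂ _+_ (fromℕ≡·1 m) (fromℕ≡·1 n) ⟨
    fromℕ m + fromℕ n   ∎

  fromℕ-homo-* : ∀ m n → fromℕ (m ℕ.* n) ≈ fromℕ m * fromℕ n
  fromℕ-homo-* m n = begin
    fromℕ (m ℕ.* n)       ≡⟨ fromℕ≡·1 (m ℕ.* n) ⟩
    (m ℕ.* n) · 1#        ≈⟨ ×1-homo-* m n ⟩
    (m · 1#) * (n · 1#)   ≡⟨ ≡.cong₂ _*_ (fromℕ≡·1 m) (fromℕ≡·1 n) ⟨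
    fromℕ m * fromℕ n     ∎

  fromℤ-homo‿- : ∀ i → fromℤ (ℤ.- i) ≈ - fromℤ i
  fromℤ-homo‿- -[1+ n ]  = sym (-‿involutive _)
  fromℤ-homo‿- (+ zero)  = sym -0#≈0#
  fromℤ-homo‿- (+ suc n) = refl

  -‿cancel-+ˡ : ∀ a x y → (a + x) - (a + y) ≈ x - y
  -‿cancel-+ˡ a x y = begin
    (a + x) - (a + y)       ≈⟨ +-congˡ (-‿anti-homo-+ a y) ⟩
    (a + x) + (- y - a)     ≈⟨ +-assoc a x _ ⟩
    a + (x + (- y - a))     ≈⟨ +-congˡ (+-assoc x (- y) (- a)) ⟨
    a + ((x - y) - a)       ≈⟨ +-congˡ (+-comm _ (- a)) ⟩
    a + (- a + (x - y))     ≈⟨ +-assoc a (- a) _ ⟨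
    (a - a) + (x - y)       ≈⟨ +-congʳ (-‿inverseʳ a) ⟩
    0# + (x - y)            ≈⟨ +-identityˡ _ ⟩
    x - y                   ∎

  fromℤ-⊖ : ∀ m n → fromℤ (m ℤ.⊖ n) ≈ fromℕ m - fromℕ n
  fromℤ-⊖ m       zero    = sym (trans (+-congˡ -0#≈0#) (+-identityʳ _))
  fromℤ-⊖ zero    (suc n) = sym (+-identityˡ _)
  fromℤ-⊖ (suc m) (suc n) = begin
    fromℤ (suc m ℤ.⊖ suc n)    ≡⟨ ≡.cong fromℤ (ℤ.[1+m]⊖[1+n]≡m⊖n m n) ⟩
    fromℤ (m ℤ.⊖ n)            ≈⟨ fromℤ-⊖ m n ⟩
    fromℕ m - fromℕ n          ≈⟨ -‿cancel-+ˡ 1# (fromℕ m) (fromℕ n) ⟨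
    fromℕ (suc m) - fromℕ (suc n) ∎

  fromℤ-homo-+ : ∀ i j → fromℤ (i ℤ.+ j) ≈ fromℤ i + fromℤ j
  fromℤ-homo-+ (+ m)    (+ n)    = fromℕ-homo-+ m n
  fromℤ-homo-+ (+ m)    -[1+ n ] = fromℤ-⊖ m (suc n)
  fromℤ-homo-+ -[1+ m ] (+ n)    = trans (fromℤ-⊖ n (suc m)) (+-comm _ _)
  fromℤ-homo-+ -[1+ m ] -[1+ n ] = begin
    - fromℕ (suc (suc (m ℕ.+ n)))            ≈⟨ -‿cong (+-congˡ (fromℕ-homo-+ (suc m) n)) ⟩
    - (1# + (fromℕ (suc m) + fromℕ n))       ≈⟨ -‿cong (+-assoc 1# _ _) ⟨
    - ((1# + fromℕ (suc m)) + fromℕ n)       ≈⟨ -‿cong (+-congʳ (+-comm 1# _)) ⟩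
    - ((fromℕ (suc m) + 1#) + fromℕ n)       ≈⟨ -‿cong (+-assoc _ 1# _) ⟩
    - (fromℕ (suc m) + fromℕ (suc n))        ≈⟨ -‿anti-homo-+ _ _ ⟩
    - fromℕ (suc n) - fromℕ (suc m)          ≈⟨ +-comm _ _ ⟩
    - fromℕ (suc m) - fromℕ (suc n)          ∎

  fromℤ-homo-*⁺ : ∀ m j → fromℤ (+ m ℤ.* j) ≈ fromℕ m * fromℤ j
  fromℤ-homo-*⁺ m (+ n) = begin
    fromℤ (+ m ℤ.* + n)   ≡⟨ ≡.cong fromℤ (ℤ.pos-* m n) ⟨
    fromℕ (m ℕ.* n)       ≈⟨ fromℕ-homo-* m n ⟩
    fromℕ m * fromℕ n     ∎
  fromℤ-homo-*⁺ m -[1+ n ] = begin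
    fromℤ (+ m ℤ.* ℤ.- + suc n)   ≡⟨ ≡.cong fromℤ (ℤ.neg-distribʳ-* (+ m) (+ suc n)) ⟨
    fromℤ (ℤ.- (+ m ℤ.* + suc n)) ≈⟨ fromℤ-homo‿- (+ m ℤ.* + suc n) ⟩
    - fromℤ (+ m ℤ.* + suc n)     ≈⟨ -‿cong (fromℤ-homo-*⁺ m (+ suc n)) ⟩
    - (fromℕ m * fromℕ (suc n))   ≈⟨ -‿distribʳ-* _ _ ⟩
    fromℕ m * - fromℕ (suc n)     ∎

  fromℤ-homo-* : ∀ i j → fromℤ (i ℤ.* j) ≈ fromℤ i * fromℤ j
  fromℤ-homo-* (+ m)    j = fromℤ-homo-*⁺ m j
  fromℤ-homo-* -[1+ m ] j = begin
    fromℤ (ℤ.- + suc m ℤ.* j)     ≡⟨ ≡.cong fromℤ (ℤ.neg-distribˡ-* (+ suc m) j) ⟨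
    fromℤ (ℤ.- (+ suc m ℤ.* j))   ≈⟨ fromℤ-homo‿- (+ suc m ℤ.* j) ⟩
    - fromℤ (+ suc m ℤ.* j)       ≈⟨ -‿cong (fromℤ-homo-*⁺ (suc m) j) ⟩
    - (fromℕ (suc m) * fromℤ j)   ≈⟨ -‿distribˡ-* _ _ ⟩
    - fromℕ (suc m) * fromℤ j     ∎

  -- ι agrees with fromℤ but sends + 1 to 1# on the nose, so that the
  -- solver constant con (+ 1) evaluates to 1# definitionally.
  ιℕ : ℕ → Carrier
  ιℕ zero          = 0#
  ιℕ (suc zero)    = 1#
  ιℕ (suc (suc k)) = 1# + ιℕ (suc k)

  ι : ℤ → Carrier
  ι (+ k)    = ιℕ k
  ι -[1+ k ] = - ιℕ (suc k)

  ιℕ≈fromℕ : ∀ k → ιℕ k ≈ fromℕ k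
  ιℕ≈fromℕ zero          = refl
  ιℕ≈fromℕ (suc zero)    = sym (+-identityʳ 1#)
  ιℕ≈fromℕ (suc (suc k)) = +-congˡ (ιℕ≈fromℕ (suc k))

  ι≈fromℤ : ∀ i → ι i ≈ fromℤ i
  ι≈fromℤ (+ k)    = ιℕ≈fromℕ k
  ι≈fromℤ -[1+ k ] = -‿cong (ιℕ≈fromℕ (suc k))

  ι-morphism : ℤ.+-*-rawRing -Raw-AlmostCommutative⟶ fromCommutativeRing R
  ι-morphism = record
    { ⟦_⟧    = ι
    ; +-homo = λ i j → homo (ℤ._+_ i j) (fromℤ-homo-+ i j) (+-cong (ι≈fromℤ i) (ι≈fromℤ j))
    ; *-homo = λ i j → homo (ℤ._*_ i j) (fromℤ-homo-* i j) (*-cong (ι≈fromℤ i) (ι≈fromℤ j))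
    ; -‿homo = λ i → homo (ℤ.- i) (fromℤ-homo‿- i) (-‿cong (ι≈fromℤ i))
    ; 0-homo = refl
    ; 1-homo = refl
    }
    where
    homo : ∀ {y} k → fromℤ k ≈ y → ∀ {x} → x ≈ y → ι k ≈ x
    homo k fromℤ-k≈y x≈y = trans (ι≈fromℤ k) (trans fromℤ-k≈y (sym x≈y))

  ι-≟ : ∀ i j → Maybe (ι i ≈ ι j)
  ι-≟ i j with i ℤ.≟ j
  ... | yes ≡.refl = just refl
  ... | no _       = nothing

  module Solver = Algebra.Solver.Ring ℤ.+-*-rawRing (fromCommutativeRing R) ι-morphism ι-≟

ιℕ-ℤ≡+ : ∀ k → IntegerImage.ιℕ ℤ-ring k ≡ + k
ιℕ-ℤ≡+ zero          = ≡.refl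
ιℕ-ℤ≡+ (suc zero)    = ≡.refl
ιℕ-ℤ≡+ (suc (suc k)) = ≡.cong (ℤ._+_ (+ 1)) (ιℕ-ℤ≡+ (suc k))

ι-ℤ≡id : ∀ k → IntegerImage.ι ℤ-ring k ≡ k
ι-ℤ≡id (+ k)    = ιℕ-ℤ≡+ k
ι-ℤ≡id -[1+ k ] = ≡.cong ℤ.-_ (ιℕ-ℤ≡+ (suc k))

record Series {a} (A : Set a) : Set a where
  constructor series
  field s₀ s₁ s₂ s₃ s₄ s₅ : A
open Series public

mapₛ : ∀ {a b} {A : Set a} {B : Set b} → (A → B) → Series A → Series B
mapₛ f x = series (f (s₀ x)) (f (s₁ x)) (f (s₂ x)) (f (s₃ x)) (f (s₄ x)) (f (s₅ x))

coefficients : ∀ {a} {A : Set a} → Series A → Vec A 6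
coefficients x = s₀ x ∷ s₁ x ∷ s₂ x ∷ s₃ x ∷ s₄ x ∷ s₅ x ∷ []

module SeriesOps {a ℓ} (𝓡 : RawRing a ℓ) (ι : ℤ → RawRing.Carrier 𝓡) where
  open RawRing 𝓡 renaming (Carrier to A)

  infixl 6 _-_ _+ₛ_
  infixl 7 _*ₛ_ _·ₛ_
  infix  8 -ₛ_

  _-_ : A → A → A
  x - y = x + (- y)

  _+ₛ_ : Series A → Series A → Series A
  x +ₛ y = series (s₀ x + s₀ y) (s₁ x + s₁ y) (s₂ x + s₂ y)
                  (s₃ x + s₃ y) (s₄ x + s₄ y) (s₅ x + s₅ y)

  _*ₛ_ : Series A → Series A → Series A
  x *ₛ y = series
    (s₀ x * s₀ y)
    (s₀ x * s₁ y + s₁ x * s₀ y)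
    (s₀ x * s₂ y + s₁ x * s₁ y + s₂ x * s₀ y)
    (s₀ x * s₃ y + s₁ x * s₂ y + s₂ x * s₁ y + s₃ x * s₀ y)
    (s₀ x * s₄ y + s₁ x * s₃ y + s₂ x * s₂ y + s₃ x * s₁ y + s₄ x * s₀ y)
    (s₀ x * s₅ y + s₁ x * s₄ y + s₂ x * s₃ y + s₃ x * s₂ y + s₄ x * s₁ y + s₅ x * s₀ y)

  -ₛ_ : Series A → Series A
  -ₛ x = mapₛ -_ x

  _·ₛ_ : A → Series A → Series A
  c ·ₛ x = mapₛ (c *_) x

  const : A → Series A
  const c = series c 0# 0# 0# 0# 0#

  0ₛ 1ₛ t : Series A
  0ₛ = const 0#
  1ₛ = const 1#
  t  = series 0# 1# 0# 0# 0# 0#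

  -- 1 - x t, the reversal of the linear factor X - x
  linear : A → Series A
  linear x = series 1# (- x) 0# 0# 0# 0#

  geometric : A → Series A
  geometric x = series 1# x (x * x) (x * x * x) (x * x * x * x) (x * x * x * x * x)

  leading1 : Series A → Series A
  leading1 x = series 1# (s₁ x) (s₂ x) (s₃ x) (s₄ x) (s₅ x)

  truncate₂ truncate₄ : Series A → Series A
  truncate₂ x = series (s₀ x) (s₁ x) 0# 0# 0# 0#
  truncate₄ x = series (s₀ x) (s₁ x) (s₂ x) (s₃ x) 0# 0#

  -- Newton's identities: for x = Π (1 - λᵢ t) these are Σ λᵢ⁴ and Σ λᵢ⁵.
  newton₄ newton₅ : Series A → A
  newton₄ x = s₁ x * s₁ x * s₁ x * s₁ x - ι (+ 4) * (s₁ x * s₁ x * s₂ x)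
            + ι (+ 4) * (s₁ x * s₃ x) + ι (+ 2) * (s₂ x * s₂ x) - ι (+ 4) * s₄ x
  newton₅ x = - (s₁ x * s₁ x * s₁ x * s₁ x * s₁ x) + ι (+ 5) * (s₁ x * s₁ x * s₁ x * s₂ x)
            - ι (+ 5) * (s₁ x * s₁ x * s₃ x) - ι (+ 5) * (s₁ x * s₂ x * s₂ x)
            + ι (+ 5) * (s₁ x * s₄ x) + ι (+ 5) * (s₂ x * s₃ x) - ι (+ 5) * s₅ x

module SeriesRing {c ℓ : Level} (R : CommutativeRing c ℓ) where
  open CommutativeRing R
  open IntegerImage R using (ι; module Solver)
  open Solver using (Polynomial; con; var; _:+_; _:*_; :-_; ⟦_⟧; ⟦_⟧N; normalise; correct)
  open SeriesOps rawRing ι public hiding (_-_)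

  polynomialRawRing : ℕ → RawRing _ _
  polynomialRawRing k = record
    { Carrier = Polynomial k ; _≈_ = _≡_ ; _+_ = _:+_ ; _*_ = _:*_ ; -_ = :-_
    ; 0# = con (+ 0) ; 1# = con (+ 1) }

  module Syntax {k : ℕ} where
    open Solver public using (Polynomial; con; _:+_; _:*_; :-_)
    open SeriesOps (polynomialRawRing k) con public
      renaming ( _-_ to _:-_; _+ₛ_ to _:+ₛ_; _*ₛ_ to _:*ₛ_; -ₛ_ to :-ₛ_; _·ₛ_ to _:·ₛ_
               ; const to :const; 0ₛ to :0ₛ; 1ₛ to :1ₛ; t to :t; linear to :linear
               ; geometric to :geometric; truncate₂ to :truncate₂; truncate₄ to :truncate₄
               ; leading1 to :leading1; newton₄ to :newton₄; newton₅ to :newton₅ )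
  open Syntax

  infix 4 _≈ₛ_
  record _≈ₛ_ (x y : Series Carrier) : Set ℓ where
    constructor ≈-series
    field ≈₀ : s₀ x ≈ s₀ y
          ≈₁ : s₁ x ≈ s₁ y
          ≈₂ : s₂ x ≈ s₂ y
          ≈₃ : s₃ x ≈ s₃ y
          ≈₄ : s₄ x ≈ s₄ y
          ≈₅ : s₅ x ≈ s₅ y
  open _≈ₛ_ public

  ≈ₛ-refl : ∀ {x} → x ≈ₛ x
  ≈ₛ-refl = ≈-series refl refl refl refl refl refl

  ≈ₛ-sym : ∀ {x y} → x ≈ₛ y → y ≈ₛ x
  ≈ₛ-sym (≈-series e₀ e₁ e₂ e₃ e₄ e₅) = ≈-series (sym e₀) (sym e₁) (sym e₂) (sym e₃) (sym e₄) (sym e₅)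

  ≈ₛ-trans : ∀ {x y z} → x ≈ₛ y → y ≈ₛ z → x ≈ₛ z
  ≈ₛ-trans (≈-series e₀ e₁ e₂ e₃ e₄ e₅) (≈-series f₀ f₁ f₂ f₃ f₄ f₅) =
    ≈-series (trans e₀ f₀) (trans e₁ f₁) (trans e₂ f₂) (trans e₃ f₃) (trans e₄ f₄) (trans e₅ f₅)

  +ₛ-cong : ∀ {x x′ y y′} → x ≈ₛ x′ → y ≈ₛ y′ → x +ₛ y ≈ₛ x′ +ₛ y′
  +ₛ-cong (≈-series e₀ e₁ e₂ e₃ e₄ e₅) (≈-series f₀ f₁ f₂ f₃ f₄ f₅) =
    ≈-series (+-cong e₀ f₀) (+-cong e₁ f₁) (+-cong e₂ f₂) (+-cong e₃ f₃) (+-cong e₄ f₄) (+-cong e₅ f₅)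

  -ₛ-cong : ∀ {x x′} → x ≈ₛ x′ → -ₛ x ≈ₛ -ₛ x′
  -ₛ-cong (≈-series e₀ e₁ e₂ e₃ e₄ e₅) =
    ≈-series (-‿cong e₀) (-‿cong e₁) (-‿cong e₂) (-‿cong e₃) (-‿cong e₄) (-‿cong e₅)

  *ₛ-cong : ∀ {x x′ y y′} → x ≈ₛ x′ → y ≈ₛ y′ → x *ₛ y ≈ₛ x′ *ₛ y′
  *ₛ-cong (≈-series e₀ e₁ e₂ e₃ e₄ e₅) (≈-series f₀ f₁ f₂ f₃ f₄ f₅) = ≈-series
    (e₀ ⊛ f₀)
    (e₀ ⊛ f₁ ⊕ e₁ ⊛ f₀)
    (e₀ ⊛ f₂ ⊕ e₁ ⊛ f₁ ⊕ e₂ ⊛ f₀)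
    (e₀ ⊛ f₃ ⊕ e₁ ⊛ f₂ ⊕ e₂ ⊛ f₁ ⊕ e₃ ⊛ f₀)
    (e₀ ⊛ f₄ ⊕ e₁ ⊛ f₃ ⊕ e₂ ⊛ f₂ ⊕ e₃ ⊛ f₁ ⊕ e₄ ⊛ f₀)
    (e₀ ⊛ f₅ ⊕ e₁ ⊛ f₄ ⊕ e₂ ⊛ f₃ ⊕ e₃ ⊛ f₂ ⊕ e₄ ⊛ f₁ ⊕ e₅ ⊛ f₀)
    where
    infixl 6 _⊕_
    infixl 7 _⊛_
    _⊕_ : ∀ {a a′ b b′} → a ≈ a′ → b ≈ b′ → a + b ≈ a′ + b′
    _⊕_ = +-cong
    _⊛_ : ∀ {a a′ b b′} → a ≈ a′ → b ≈ b′ → a * b ≈ a′ * b′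
    _⊛_ = *-cong

  -- An identity between series and scalars over R holds once both sides have equal
  -- normal forms as polynomials in the coefficients of the series and in the scalars.
  Arity : ℕ → ℕ → ℕ
  Arity j k = j ℕ.* 6 ℕ.+ k

  env : ∀ {j k} → Vec (Series Carrier) j → Vec Carrier k → Vec Carrier (Arity j k)
  env xs cs = concat (Vec.map coefficients xs) Vec.++ cs

  seriesVariables : ∀ {j k} → Vec (Series (Polynomial (Arity j k))) j
  seriesVariables {k = k} = tabulate λ i → series (x i (# 0)) (x i (# 1)) (x i (# 2)) (x i (# 3)) (x i (# 4)) (x i (# 5))
    where
    x : ∀ {j} → Fin j → Fin 6 → Polynomial (Arity j k)
    x i r = var (combine i r ↑ˡ k)

  scalarVariables : ∀ {j k} → Vec (Polynomial (Arity j k)) k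
  scalarVariables {j} = tabulate λ i → var ((j ℕ.* 6) ↑ʳ i)

  Identity : ℕ → ℕ → Set → Set
  Identity j k X = Vec (Series (Polynomial (Arity j k))) j → Vec (Polynomial (Arity j k)) k → X × X

  ⟦_⟧ₛ : ∀ {k} → Series (Polynomial k) → Vec Carrier k → Series Carrier
  ⟦ p ⟧ₛ ρ = mapₛ (λ q → ⟦ q ⟧ ρ) p

  private
    via-normal-forms : ∀ {k} (ρ : Vec Carrier k) (p q : Polynomial k) →
                       normalise p ≡ normalise q → ⟦ p ⟧ ρ ≈ ⟦ q ⟧ ρ
    via-normal-forms ρ p q eq =
      trans (sym (correct p ρ)) (trans (reflexive (≡.cong (λ n → ⟦ n ⟧N ρ) eq)) (correct q ρ))

  module _ {j k} (xs : Vec (Series Carrier) j) (cs : Vec Carrier k) where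

    private
      𝑥s : Vec (Series (Polynomial (Arity j k))) j
      𝑥s = seriesVariables {j} {k}
      𝑐s : Vec (Polynomial (Arity j k)) k
      𝑐s = scalarVariables {j} {k}

    prove : (e : Identity j k (Polynomial (Arity j k))) →
            normalise (proj₁ (e 𝑥s 𝑐s)) ≡ normalise (proj₂ (e 𝑥s 𝑐s)) →
            ⟦ proj₁ (e 𝑥s 𝑐s) ⟧ (env xs cs) ≈ ⟦ proj₂ (e 𝑥s 𝑐s) ⟧ (env xs cs)
    prove e = via-normal-forms (env xs cs) (proj₁ (e 𝑥s 𝑐s)) (proj₂ (e 𝑥s 𝑐s))

    proveₛ : (e : Identity j k (Series (Polynomial (Arity j k)))) →
             mapₛ normalise (proj₁ (e 𝑥s 𝑐s)) ≡ mapₛ normalise (proj₂ (e 𝑥s 𝑐s)) →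
             ⟦ proj₁ (e 𝑥s 𝑐s) ⟧ₛ (env xs cs) ≈ₛ ⟦ proj₂ (e 𝑥s 𝑐s) ⟧ₛ (env xs cs)
    proveₛ e eq = ≈-series
      (by (s₀ lhs) (s₀ rhs) (≡.cong s₀ eq)) (by (s₁ lhs) (s₁ rhs) (≡.cong s₁ eq))
      (by (s₂ lhs) (s₂ rhs) (≡.cong s₂ eq)) (by (s₃ lhs) (s₃ rhs) (≡.cong s₃ eq))
      (by (s₄ lhs) (s₄ rhs) (≡.cong s₄ eq)) (by (s₅ lhs) (s₅ rhs) (≡.cong s₅ eq))
      where
      lhs rhs : Series (Polynomial (Arity j k))
      lhs = proj₁ (e 𝑥s 𝑐s)
      rhs = proj₂ (e 𝑥s 𝑐s)
      by : ∀ p q → normalise p ≡ normalise q → ⟦ p ⟧ (env xs cs) ≈ ⟦ q ⟧ (env xs cs)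
      by = via-normal-forms (env xs cs)

  *ₛ-comm : ∀ x y → x *ₛ y ≈ₛ y *ₛ x
  *ₛ-comm x y = proveₛ (x ∷ y ∷ []) [] (λ where (X ∷ Y ∷ []) [] → X :*ₛ Y , Y :*ₛ X) ≡.refl

  *ₛ-assoc : ∀ x y z → (x *ₛ y) *ₛ z ≈ₛ x *ₛ (y *ₛ z)
  *ₛ-assoc x y z = proveₛ (x ∷ y ∷ z ∷ []) [] (λ where
    (X ∷ Y ∷ Z ∷ []) [] → (X :*ₛ Y) :*ₛ Z , X :*ₛ (Y :*ₛ Z)) ≡.refl

  *ₛ-identityˡ : ∀ x → 1ₛ *ₛ x ≈ₛ x
  *ₛ-identityˡ x = proveₛ (x ∷ []) [] (λ where (X ∷ []) [] → :1ₛ :*ₛ X , X) ≡.refl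

  *ₛ-identityʳ : ∀ x → x *ₛ 1ₛ ≈ₛ x
  *ₛ-identityʳ x = proveₛ (x ∷ []) [] (λ where (X ∷ []) [] → X :*ₛ :1ₛ , X) ≡.refl

  *ₛ-zeroʳ : ∀ x → x *ₛ 0ₛ ≈ₛ 0ₛ
  *ₛ-zeroʳ x = proveₛ (x ∷ []) [] (λ where (X ∷ []) [] → X :*ₛ :0ₛ , :0ₛ) ≡.refl

  +ₛ-comm : ∀ x y → x +ₛ y ≈ₛ y +ₛ x
  +ₛ-comm x y = proveₛ (x ∷ y ∷ []) [] (λ where (X ∷ Y ∷ []) [] → X :+ₛ Y , Y :+ₛ X) ≡.refl

  +ₛ-assoc : ∀ x y z → (x +ₛ y) +ₛ z ≈ₛ x +ₛ (y +ₛ z)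
  +ₛ-assoc x y z = proveₛ (x ∷ y ∷ z ∷ []) [] (λ where
    (X ∷ Y ∷ Z ∷ []) [] → (X :+ₛ Y) :+ₛ Z , X :+ₛ (Y :+ₛ Z)) ≡.refl

  +ₛ-identityˡ : ∀ x → 0ₛ +ₛ x ≈ₛ x
  +ₛ-identityˡ x = proveₛ (x ∷ []) [] (λ where (X ∷ []) [] → :0ₛ :+ₛ X , X) ≡.refl

  +ₛ-identityʳ : ∀ x → x +ₛ 0ₛ ≈ₛ x
  +ₛ-identityʳ x = proveₛ (x ∷ []) [] (λ where (X ∷ []) [] → X :+ₛ :0ₛ , X) ≡.refl

  -ₛ-inverseˡ : ∀ x → -ₛ x +ₛ x ≈ₛ 0ₛ
  -ₛ-inverseˡ x = proveₛ (x ∷ []) [] (λ where (X ∷ []) [] → :-ₛ X :+ₛ X , :0ₛ) ≡.refl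

  -ₛ-inverseʳ : ∀ x → x +ₛ -ₛ x ≈ₛ 0ₛ
  -ₛ-inverseʳ x = proveₛ (x ∷ []) [] (λ where (X ∷ []) [] → X :+ₛ :-ₛ X , :0ₛ) ≡.refl

  *ₛ-distribˡ : ∀ x y z → x *ₛ (y +ₛ z) ≈ₛ x *ₛ y +ₛ x *ₛ z
  *ₛ-distribˡ x y z = proveₛ (x ∷ y ∷ z ∷ []) [] (λ where
    (X ∷ Y ∷ Z ∷ []) [] → X :*ₛ (Y :+ₛ Z) , X :*ₛ Y :+ₛ X :*ₛ Z) ≡.refl

  *ₛ-distribʳ : ∀ x y z → (y +ₛ z) *ₛ x ≈ₛ y *ₛ x +ₛ z *ₛ x
  *ₛ-distribʳ x y z = proveₛ (x ∷ y ∷ z ∷ []) [] (λ where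
    (X ∷ Y ∷ Z ∷ []) [] → (Y :+ₛ Z) :*ₛ X , Y :*ₛ X :+ₛ Z :*ₛ X) ≡.refl

  ·ₛ-congʳ : ∀ a {x y} → x ≈ₛ y → a ·ₛ x ≈ₛ a ·ₛ y
  ·ₛ-congʳ a (≈-series e₀ e₁ e₂ e₃ e₄ e₅) =
    ≈-series (*-congˡ e₀) (*-congˡ e₁) (*-congˡ e₂) (*-congˡ e₃) (*-congˡ e₄) (*-congˡ e₅)

  ·ₛ-*ₛ : ∀ a x y → a ·ₛ (x *ₛ y) ≈ₛ x *ₛ (a ·ₛ y)
  ·ₛ-*ₛ a x y = proveₛ (x ∷ y ∷ []) (a ∷ []) (λ where
    (X ∷ Y ∷ []) (A ∷ []) → A :·ₛ (X :*ₛ Y) , X :*ₛ (A :·ₛ Y)) ≡.refl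

  series-isCommutativeRing : IsCommutativeRing _≈ₛ_ _+ₛ_ _*ₛ_ -ₛ_ 0ₛ 1ₛ
  series-isCommutativeRing = record
    { isRing = record
      { +-isAbelianGroup = record
        { isGroup = record
          { isMonoid = record
            { isSemigroup = record
              { isMagma = record
                { isEquivalence = record { refl = ≈ₛ-refl ; sym = ≈ₛ-sym ; trans = ≈ₛ-trans }
                ; ∙-cong = +ₛ-cong }
              ; assoc = +ₛ-assoc }
            ; identity = +ₛ-identityˡ , +ₛ-identityʳ }
          ; inverse = -ₛ-inverseˡ , -ₛ-inverseʳ
          ; ⁻¹-cong = -ₛ-cong }
        ; comm = +ₛ-comm }
      ; *-cong = *ₛ-cong
      ; *-assoc = *ₛ-assoc
      ; *-identity = *ₛ-identityˡ , *ₛ-identityʳ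
      ; distrib = *ₛ-distribˡ , *ₛ-distribʳ }
    ; *-comm = *ₛ-comm }

  seriesRing : CommutativeRing c ℓ
  seriesRing = record { isCommutativeRing = series-isCommutativeRing }

module _ {n : ℕ} where

  ==⇒≡ : ∀ {x y : Fin n} → (x == y) ≡ true → x ≡ y
  ==⇒≡ {x} {y} eq with x Data.Fin.≟ y
  ... | yes x≡y = x≡y

  ==-refl : ∀ (x : Fin n) → (x == x) ≡ true
  ==-refl x with x Data.Fin.≟ x
  ... | yes _   = ≡.refl
  ... | no x≢x = contradiction ≡.refl x≢x

  ==-sym : ∀ (x y : Fin n) → (x == y) ≡ (y == x)
  ==-sym x y with x Data.Fin.≟ y | y Data.Fin.≟ x
  ... | yes _   | yes _   = ≡.refl
  ... | no _    | no _    = ≡.refl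
  ... | yes x≡y | no y≢x  = contradiction (≡.sym x≡y) y≢x
  ... | no x≢y  | yes y≡x = contradiction (≡.sym y≡x) x≢y

  ==-suc : ∀ (x y : Fin n) → (Fin.suc x == Fin.suc y) ≡ (x == y)
  ==-suc x y with x Data.Fin.≟ y
  ... | yes _ = ≡.refl
  ... | no _  = ≡.refl

module ListSums {c ℓ : Level} (S : CommutativeRing c ℓ) where
  open CommutativeRing S
  open import Relation.Binary.Reasoning.Setoid setoid
  open import Algebra.Properties.Ring ring using (-0#≈0#; -‿+-comm)
  open import Algebra.Properties.CommutativeSemigroup +-commutativeSemigroup using (interchange)

  ∑ ∏ : ∀ {X : Set} → (X → Carrier) → List X → Carrier
  ∑ f xs = foldr _+_ 0# (List.map f xs)
  ∏ f xs = foldr _*_ 1# (List.map f xs)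
  syntax ∑ (λ x → e) xs = ∑[ x ∈ xs ] e
  syntax ∏ (λ x → e) xs = ∏[ x ∈ xs ] e

  module _ {X : Set} where

    ∑-cong : ∀ {f g : X → Carrier} → (∀ x → f x ≈ g x) → ∀ xs → ∑ f xs ≈ ∑ g xs
    ∑-cong f≈g []       = refl
    ∑-cong f≈g (x ∷ xs) = +-cong (f≈g x) (∑-cong f≈g xs)

    ∑-congᴬˡˡ : ∀ {f g : X → Carrier} {xs} → All (λ x → f x ≈ g x) xs → ∑ f xs ≈ ∑ g xs
    ∑-congᴬˡˡ []           = refl
    ∑-congᴬˡˡ (fx≈gx ∷ eqs) = +-cong fx≈gx (∑-congᴬˡˡ eqs)

    ∏-cong : ∀ {f g : X → Carrier} → (∀ x → f x ≈ g x) → ∀ xs → ∏ f xs ≈ ∏ g xs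
    ∏-cong f≈g []       = refl
    ∏-cong f≈g (x ∷ xs) = *-cong (f≈g x) (∏-cong f≈g xs)

    ∑-distrib-+ : ∀ (f g : X → Carrier) xs → ∑[ x ∈ xs ] (f x + g x) ≈ ∑ f xs + ∑ g xs
    ∑-distrib-+ f g []       = sym (+-identityʳ 0#)
    ∑-distrib-+ f g (x ∷ xs) = trans (+-congˡ (∑-distrib-+ f g xs)) (interchange _ _ _ _)

    ∏-distrib-* : ∀ (f g : X → Carrier) xs → ∏[ x ∈ xs ] (f x * g x) ≈ ∏ f xs * ∏ g xs
    ∏-distrib-* f g []       = sym (*-identityʳ 1#)
    ∏-distrib-* f g (x ∷ xs) = trans (*-congˡ (∏-distrib-* f g xs)) (*-interchange _ _ _ _)
      where open import Algebra.Properties.CommutativeSemigroup *-commutativeSemigroup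
              using () renaming (interchange to *-interchange)

    *-distribˡ-∑ : ∀ a (f : X → Carrier) xs → ∑[ x ∈ xs ] (a * f x) ≈ a * ∑ f xs
    *-distribˡ-∑ a f []       = sym (zeroʳ a)
    *-distribˡ-∑ a f (x ∷ xs) = trans (+-congˡ (*-distribˡ-∑ a f xs)) (sym (distribˡ a _ _))

    *-distribʳ-∑ : ∀ a (f : X → Carrier) xs → ∑[ x ∈ xs ] (f x * a) ≈ ∑ f xs * a
    *-distribʳ-∑ a f []       = sym (zeroˡ a)
    *-distribʳ-∑ a f (x ∷ xs) = trans (+-congˡ (*-distribʳ-∑ a f xs)) (sym (distribʳ a _ _))

    -‿distrib-∑ : ∀ (f : X → Carrier) xs → ∑[ x ∈ xs ] (- f x) ≈ - ∑ f xs
    -‿distrib-∑ f []       = sym -0#≈0#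
    -‿distrib-∑ f (x ∷ xs) = trans (+-congˡ (-‿distrib-∑ f xs)) (-‿+-comm _ _)

    ∑-zero : ∀ (xs : List X) → ∑[ x ∈ xs ] 0# ≈ 0#
    ∑-zero []       = refl
    ∑-zero (x ∷ xs) = trans (+-identityˡ _) (∑-zero xs)

    ∑-++ : ∀ (f : X → Carrier) xs ys → ∑ f (xs ++ ys) ≈ ∑ f xs + ∑ f ys
    ∑-++ f []       ys = sym (+-identityˡ _)
    ∑-++ f (x ∷ xs) ys = trans (+-congˡ (∑-++ f xs ys)) (sym (+-assoc _ _ _))

    ∑-filterᵇ : ∀ (p : X → Bool) (f : X → Carrier) xs →
                ∑ f (filterᵇ p xs) ≈ ∑[ x ∈ xs ] (if p x then f x else 0#)
    ∑-filterᵇ p f []       = refl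
    ∑-filterᵇ p f (x ∷ xs) with p x
    ... | true  = +-congˡ (∑-filterᵇ p f xs)
    ... | false = trans (∑-filterᵇ p f xs) (sym (+-identityˡ _))

  ∑-map : ∀ {X Y : Set} (f : Y → Carrier) (g : X → Y) xs → ∑ f (List.map g xs) ≡ ∑[ x ∈ xs ] f (g x)
  ∑-map f g []       = ≡.refl
  ∑-map f g (x ∷ xs) = ≡.cong (λ s → f (g x) + s) (∑-map f g xs)

  ∑-concatMap : ∀ {X Y : Set} (f : Y → Carrier) (h : X → List Y) xs →
                ∑ f (concatMap h xs) ≈ ∑[ x ∈ xs ] ∑ f (h x)
  ∑-concatMap f h []       = refl
  ∑-concatMap f h (x ∷ xs) = trans (∑-++ f (h x) (concatMap h xs)) (+-congˡ (∑-concatMap f h xs))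

  ∑-comm : ∀ {X Y : Set} (f : X → Y → Carrier) xs ys →
           ∑[ x ∈ xs ] ∑[ y ∈ ys ] f x y ≈ ∑[ y ∈ ys ] ∑[ x ∈ xs ] f x y
  ∑-comm f []       ys = sym (∑-zero ys)
  ∑-comm f (x ∷ xs) ys = trans (+-congˡ (∑-comm f xs ys)) (sym (∑-distrib-+ (f x) _ ys))


  pairSum : ∀ {X : Set} → (X → X → Carrier) → List X → Carrier
  pairSum ψ []       = 0#
  pairSum ψ (x ∷ xs) = ∑ (ψ x) xs + pairSum ψ xs

  pairSum-double : ∀ {X : Set} (ψ : X → X → Carrier) → (∀ x y → ψ x y ≈ ψ y x) → ∀ xs →
                   pairSum ψ xs + pairSum ψ xs + ∑[ x ∈ xs ] ψ x x ≈ ∑[ x ∈ xs ] ∑[ y ∈ xs ] ψ x y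
  pairSum-double ψ ψ-sym []       = trans (+-identityʳ _) (+-identityʳ 0#)
  pairSum-double ψ ψ-sym (x ∷ xs) = begin
    (r + p) + (r + p) + (ψ x x + D)  ≈⟨ regroup r p (ψ x x) D ⟩
    (ψ x x + r) + (r + (p + p + D))  ≈⟨ +-congˡ (+-cong (∑-cong (ψ-sym x) xs) (pairSum-double ψ ψ-sym xs)) ⟩
    (ψ x x + r) + (∑[ y ∈ xs ] ψ y x + ∑[ y ∈ xs ] ∑[ z ∈ xs ] ψ y z)
                                     ≈⟨ +-congˡ (∑-distrib-+ (λ y → ψ y x) (λ y → ∑ (ψ y) xs) xs) ⟨
    ∑[ y ∈ x ∷ xs ] ∑[ z ∈ x ∷ xs ] ψ y z ∎
    where
    r p D : Carrier
    r = ∑ (ψ x) xs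
    p = pairSum ψ xs
    D = ∑[ y ∈ xs ] ψ y y
    regroup : ∀ r p a D → (r + p) + (r + p) + (a + D) ≈ (a + r) + (r + (p + p + D))
    regroup = solve 4 (λ r p a D → ((r ⊕ p) ⊕ (r ⊕ p)) ⊕ (a ⊕ D) ⊜ (a ⊕ r) ⊕ (r ⊕ ((p ⊕ p) ⊕ D))) refl
      where open import Algebra.Solver.CommutativeMonoid +-commutativeMonoid using (solve; _⊕_; _⊜_)

  ∏-1 : ∀ {X : Set} (xs : List X) → ∏[ x ∈ xs ] 1# ≈ 1#
  ∏-1 []       = refl
  ∏-1 (x ∷ xs) = trans (*-identityˡ _) (∏-1 xs)

  ∏-allFin-suc : ∀ {n} (f : Fin (suc n) → Carrier) →
                 ∏ f (List.allFin (suc n)) ≡ f Fin.zero * ∏ (f ∘ Fin.suc) (List.allFin n)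
  ∏-allFin-suc {n} f = ≡.cong (λ ps → f Fin.zero * foldr _*_ 1# ps)
    (≡.trans (List.map-tabulate Fin.suc f) (≡.sym (List.map-tabulate id (f ∘ Fin.suc))))

  ∑-allFin-suc : ∀ {n} (f : Fin (suc n) → Carrier) →
                 ∑ f (List.allFin (suc n)) ≡ f Fin.zero + ∑ (f ∘ Fin.suc) (List.allFin n)
  ∑-allFin-suc {n} f = ≡.cong (λ xs → f Fin.zero + foldr _+_ 0# xs)
    (≡.trans (List.map-tabulate Fin.suc f) (≡.sym (List.map-tabulate id (f ∘ Fin.suc))))

  ∏-δ : ∀ {n} (x : Fin n) (F : Fin n → Carrier) → ∏[ v ∈ List.allFin n ] (if v == x then F v else 1#) ≈ F x
  ∏-δ {suc n} Fin.zero F = begin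
    ∏[ v ∈ List.allFin (suc n) ] (if v == Fin.zero then F v else 1#)
      ≡⟨ ∏-allFin-suc (λ v → if v == Fin.zero then F v else 1#) ⟩
    F Fin.zero * ∏[ v ∈ List.allFin n ] 1#                          ≈⟨ *-congˡ (∏-1 (List.allFin n)) ⟩
    F Fin.zero * 1#                                                 ≈⟨ *-identityʳ _ ⟩
    F Fin.zero                                                      ∎
  ∏-δ {suc n} (Fin.suc x) F = begin
    ∏[ v ∈ List.allFin (suc n) ] (if v == Fin.suc x then F v else 1#)
      ≡⟨ ∏-allFin-suc (λ v → if v == Fin.suc x then F v else 1#) ⟩
    1# * ∏[ v ∈ List.allFin n ] (if Fin.suc v == Fin.suc x then F (Fin.suc v) else 1#)
      ≈⟨ *-identityˡ _ ⟩
    ∏[ v ∈ List.allFin n ] (if Fin.suc v == Fin.suc x then F (Fin.suc v) else 1#)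
      ≈⟨ ∏-cong (λ v → reflexive (≡.cong (λ b → if b then F (Fin.suc v) else 1#) (==-suc v x))) (List.allFin n) ⟩
    ∏[ v ∈ List.allFin n ] (if v == x then F (Fin.suc v) else 1#)
      ≈⟨ ∏-δ x (F ∘ Fin.suc) ⟩
    F (Fin.suc x) ∎

  ∑-δ : ∀ {n} (x : Fin n) (F : Fin n → Carrier) → ∑[ v ∈ List.allFin n ] (if x == v then F v else 0#) ≈ F x
  ∑-δ {suc n} Fin.zero F = begin
    ∑[ v ∈ List.allFin (suc n) ] (if Fin.zero == v then F v else 0#)
      ≡⟨ ∑-allFin-suc (λ v → if Fin.zero == v then F v else 0#) ⟩
    F Fin.zero + ∑[ v ∈ List.allFin n ] 0#                          ≈⟨ +-congˡ (∑-zero (List.allFin n)) ⟩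
    F Fin.zero + 0#                                                 ≈⟨ +-identityʳ _ ⟩
    F Fin.zero                                                      ∎
  ∑-δ {suc n} (Fin.suc x) F = begin
    ∑[ v ∈ List.allFin (suc n) ] (if Fin.suc x == v then F v else 0#)
      ≡⟨ ∑-allFin-suc (λ v → if Fin.suc x == v then F v else 0#) ⟩
    0# + ∑[ v ∈ List.allFin n ] (if Fin.suc x == Fin.suc v then F (Fin.suc v) else 0#)
      ≈⟨ +-identityˡ _ ⟩
    ∑[ v ∈ List.allFin n ] (if Fin.suc x == Fin.suc v then F (Fin.suc v) else 0#)
      ≈⟨ ∑-cong (λ v → reflexive (≡.cong (λ b → if b then F (Fin.suc v) else 0#) (==-suc x v))) (List.allFin n) ⟩
    ∑[ v ∈ List.allFin n ] (if x == v then F (Fin.suc v) else 0#)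
      ≈⟨ ∑-δ x (F ∘ Fin.suc) ⟩
    F (Fin.suc x) ∎

module Reversal {c ℓ : Level} (S : CommutativeRing c ℓ) where
  open CommutativeRing S
  open InRing S using (addR; mulR; scaleR; coeffR)
  open SeriesRing S
  open Syntax
  open ListSums seriesRing using (∏)
  module ∑ₛ = ListSums seriesRing
  open import Relation.Binary.Reasoning.Setoid setoid

  coeff-addR : ∀ p q k → coeffR (addR p q) k ≈ coeffR p k + coeffR q k
  coeff-addR []      q       k       = sym (+-identityˡ _)
  coeff-addR (a ∷ p) []      k       = sym (+-identityʳ _)
  coeff-addR (a ∷ p) (b ∷ q) zero    = refl
  coeff-addR (a ∷ p) (b ∷ q) (suc k) = coeff-addR p q k

  coeff-scaleR : ∀ a p k → coeffR (scaleR a p) k ≈ a * coeffR p k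
  coeff-scaleR a []      k       = sym (zeroʳ a)
  coeff-scaleR a (b ∷ p) zero    = refl
  coeff-scaleR a (b ∷ p) (suc k) = coeff-scaleR a p k

  coeff-linear-*-zero : ∀ a b q → coeffR (mulR (a ∷ b ∷ []) q) 0 ≈ a * coeffR q 0
  coeff-linear-*-zero a b q =
    trans (coeff-addR (scaleR a q) _ 0) (trans (+-identityʳ _) (coeff-scaleR a q 0))

  coeff-linear-*-suc : ∀ a b q k →
    coeffR (mulR (a ∷ b ∷ []) q) (suc k) ≈ a * coeffR q (suc k) + b * coeffR q k
  coeff-linear-*-suc a b q k = begin
    coeffR (mulR (a ∷ b ∷ []) q) (suc k)
      ≈⟨ coeff-addR (scaleR a q) _ (suc k) ⟩
    coeffR (scaleR a q) (suc k) + coeffR (addR (scaleR b q) (0# ∷ [])) k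
      ≈⟨ +-cong (coeff-scaleR a q (suc k)) (coeff-addR (scaleR b q) _ k) ⟩
    a * coeffR q (suc k) + (coeffR (scaleR b q) k + coeffR (0# ∷ []) k)
      ≈⟨ +-congˡ (+-cong (coeff-scaleR b q k) (coeff-single-0# k)) ⟩
    a * coeffR q (suc k) + (b * coeffR q k + 0#)
      ≈⟨ +-congˡ (+-identityʳ _) ⟩
    a * coeffR q (suc k) + b * coeffR q k ∎
    where
    coeff-single-0# : ∀ k → coeffR (0# ∷ []) k ≈ 0#
    coeff-single-0# zero    = refl
    coeff-single-0# (suc k) = refl

  -- topCoeff N p j is the coefficient of X^(N ∸ j) in p (and 0 for j > N)
  topCoeff : ℕ → List Carrier → ℕ → Carrier
  topCoeff N       p zero    = coeffR p N
  topCoeff zero    p (suc j) = 0#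
  topCoeff (suc N) p (suc j) = topCoeff N p j

  -- t^N p(1/t), the reversal of p read as a polynomial of degree N
  reversed : ℕ → List Carrier → Series Carrier
  reversed N p = series (topCoeff N p 0) (topCoeff N p 1) (topCoeff N p 2)
                        (topCoeff N p 3) (topCoeff N p 4) (topCoeff N p 5)

  topCoeff-addR : ∀ N p q j → topCoeff N (addR p q) j ≈ topCoeff N p j + topCoeff N q j
  topCoeff-addR N       p q zero    = coeff-addR p q N
  topCoeff-addR zero    p q (suc j) = sym (+-identityʳ 0#)
  topCoeff-addR (suc N) p q (suc j) = topCoeff-addR N p q j

  topCoeff-scaleR : ∀ N a p j → topCoeff N (scaleR a p) j ≈ a * topCoeff N p j
  topCoeff-scaleR N       a p zero    = coeff-scaleR a p N
  topCoeff-scaleR zero    a p (suc j) = sym (zeroʳ a)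
  topCoeff-scaleR (suc N) a p (suc j) = topCoeff-scaleR N a p j

  topCoeff-[] : ∀ N j → topCoeff N [] j ≈ 0#
  topCoeff-[] N       zero    = refl
  topCoeff-[] zero    (suc j) = refl
  topCoeff-[] (suc N) (suc j) = topCoeff-[] N j

  reversed-addR : ∀ N p q → reversed N (addR p q) ≈ₛ reversed N p +ₛ reversed N q
  reversed-addR N p q = ≈-series
    (topCoeff-addR N p q 0) (topCoeff-addR N p q 1) (topCoeff-addR N p q 2)
    (topCoeff-addR N p q 3) (topCoeff-addR N p q 4) (topCoeff-addR N p q 5)

  reversed-scaleR : ∀ N a p → reversed N (scaleR a p) ≈ₛ a ·ₛ reversed N p
  reversed-scaleR N a p = ≈-series
    (topCoeff-scaleR N a p 0) (topCoeff-scaleR N a p 1) (topCoeff-scaleR N a p 2)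
    (topCoeff-scaleR N a p 3) (topCoeff-scaleR N a p 4) (topCoeff-scaleR N a p 5)

  reversed-∑ : ∀ {X : Set} N (h : X → List Carrier) xs →
               reversed N (foldr addR [] (List.map h xs)) ≈ₛ ∑ₛ.∑[ x ∈ xs ] reversed N (h x)
  reversed-∑ N h []       = ≈-series
    (topCoeff-[] N 0) (topCoeff-[] N 1) (topCoeff-[] N 2)
    (topCoeff-[] N 3) (topCoeff-[] N 4) (topCoeff-[] N 5)
  reversed-∑ N h (x ∷ xs) = ≈ₛ-trans (reversed-addR N (h x) _) (+ₛ-cong ≈ₛ-refl (reversed-∑ N h xs))

  topCoeff-linear-* : ∀ a b q N j → topCoeff (suc N) (mulR (a ∷ b ∷ []) q) (suc j) ≈
                                    a * topCoeff N q j + b * topCoeff N q (suc j)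
  topCoeff-linear-* a b q zero    zero    =
    trans (coeff-linear-*-zero a b q) (sym (trans (+-congˡ (zeroʳ b)) (+-identityʳ _)))
  topCoeff-linear-* a b q (suc N) zero    = coeff-linear-*-suc a b q N
  topCoeff-linear-* a b q zero    (suc j) = sym (trans (+-cong (zeroʳ a) (zeroʳ b)) (+-identityʳ 0#))
  topCoeff-linear-* a b q (suc N) (suc j) = topCoeff-linear-* a b q N j

  linear-*ₛ : ∀ x y → linear x *ₛ y ≈ₛ
    series (1# * s₀ y) (- x * s₀ y + 1# * s₁ y) (- x * s₁ y + 1# * s₂ y)
           (- x * s₂ y + 1# * s₃ y) (- x * s₃ y + 1# * s₄ y) (- x * s₄ y + 1# * s₅ y)
  linear-*ₛ x y = proveₛ (y ∷ []) (x ∷ []) (λ where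
    (Y ∷ []) (X ∷ []) → :linear X :*ₛ Y ,
                        series (con (+ 1) :* s₀ Y) (:- X :* s₀ Y :+ con (+ 1) :* s₁ Y)
                               (:- X :* s₁ Y :+ con (+ 1) :* s₂ Y) (:- X :* s₂ Y :+ con (+ 1) :* s₃ Y)
                               (:- X :* s₃ Y :+ con (+ 1) :* s₄ Y) (:- X :* s₄ Y :+ con (+ 1) :* s₅ Y))
    ≡.refl

  t-*ₛ : ∀ y → t *ₛ y ≈ₛ series 0# (s₀ y) (s₁ y) (s₂ y) (s₃ y) (s₄ y)
  t-*ₛ y = proveₛ (y ∷ []) [] (λ where
    (Y ∷ []) [] → :t :*ₛ Y , series (con (+ 0)) (s₀ Y) (s₁ Y) (s₂ Y) (s₃ Y) (s₄ Y)) ≡.refl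

  reversed-linear-* : ∀ x q N → coeffR q (suc N) ≈ 0# →
                      reversed (suc N) (mulR (- x ∷ 1# ∷ []) q) ≈ₛ linear x *ₛ reversed N q
  reversed-linear-* x q N deg-q≤N = ≈ₛ-trans
    (≈-series top (by 0) (by 1) (by 2) (by 3) (by 4))
    (≈ₛ-sym (linear-*ₛ x (reversed N q)))
    where
    by : ∀ j → topCoeff (suc N) (mulR (- x ∷ 1# ∷ []) q) (suc j) ≈
               - x * topCoeff N q j + 1# * topCoeff N q (suc j)
    by = topCoeff-linear-* (- x) 1# q N
    top : coeffR (mulR (- x ∷ 1# ∷ []) q) (suc N) ≈ 1# * coeffR q N
    top = begin
      coeffR (mulR (- x ∷ 1# ∷ []) q) (suc N) ≈⟨ coeff-linear-*-suc (- x) 1# q N ⟩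
      - x * coeffR q (suc N) + 1# * coeffR q N ≈⟨ +-congʳ (trans (*-congˡ deg-q≤N) (zeroʳ _)) ⟩
      0# + 1# * coeffR q N                    ≈⟨ +-identityˡ _ ⟩
      1# * coeffR q N                         ∎

  reversed-shift : ∀ q N → coeffR q (suc N) ≈ 0# → reversed (suc N) q ≈ₛ t *ₛ reversed N q
  reversed-shift q N deg-q≤N =
    ≈ₛ-trans (≈-series deg-q≤N refl refl refl refl refl) (≈ₛ-sym (t-*ₛ (reversed N q)))

  linearProduct : ∀ {X : Set} → (X → Bool) → (X → Carrier) → List X → List Carrier
  linearProduct p F xs = foldr mulR (1# ∷ []) (List.map (λ v → - F v ∷ 1# ∷ []) (filterᵇ p xs))

  module _ {X : Set} (p : X → Bool) (F : X → Carrier) where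

    linearProduct-degree : ∀ xs k → List.length xs ℕ.< k → coeffR (linearProduct p F xs) k ≈ 0#
    linearProduct-degree []       (suc k) _ = refl
    linearProduct-degree (v ∷ xs) k len<k with p v
    linearProduct-degree (v ∷ xs) (suc k) (s≤s len≤k) | true = begin
      coeffR (mulR (- F v ∷ 1# ∷ []) q) (suc k)    ≈⟨ coeff-linear-*-suc (- F v) 1# q k ⟩
      - F v * coeffR q (suc k) + 1# * coeffR q k   ≈⟨ +-cong (*-congˡ (linearProduct-degree xs (suc k) (ℕ.m≤n⇒m≤1+n len≤k)))
                                                            (*-congˡ (linearProduct-degree xs k len≤k)) ⟩
      - F v * 0# + 1# * 0#                         ≈⟨ +-cong (zeroʳ _) (zeroʳ _) ⟩
      0# + 0#                                      ≈⟨ +-identityʳ 0# ⟩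
      0#                                           ∎
      where
      q : List Carrier
      q = linearProduct p F xs
    linearProduct-degree (v ∷ xs) (suc k) (s≤s len≤k) | false =
      linearProduct-degree xs (suc k) (ℕ.m≤n⇒m≤1+n len≤k)

    reversed-linearProduct : ∀ xs → reversed (List.length xs) (linearProduct p F xs) ≈ₛ
                                    ∏[ v ∈ xs ] (if p v then linear (F v) else t)
    reversed-linearProduct []       = ≈ₛ-refl
    reversed-linearProduct (v ∷ xs) with p v
    ... | true  = ≈ₛ-trans (reversed-linear-* (F v) (linearProduct p F xs) (List.length xs)
                                              (linearProduct-degree xs _ ℕ.≤-refl))
                           (*ₛ-cong ≈ₛ-refl (reversed-linearProduct xs))
    ... | false = ≈ₛ-trans (reversed-shift (linearProduct p F xs) (List.length xs)
                                           (linearProduct-degree xs _ ℕ.≤-refl))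
                           (*ₛ-cong ≈ₛ-refl (reversed-linearProduct xs))


  reversed-linearProduct-allFin : ∀ {n} (p : Fin n → Bool) (F : Fin n → Carrier) →
    reversed n (linearProduct p F (List.allFin n)) ≈ₛ ∏[ v ∈ List.allFin n ] (if p v then linear (F v) else t)
  reversed-linearProduct-allFin {n} p F =
    ≡.subst (λ N → reversed N (linearProduct p F (List.allFin n)) ≈ₛ
                   ∏[ v ∈ List.allFin n ] (if p v then linear (F v) else t))
            (List.length-tabulate id) (reversed-linearProduct p F (List.allFin n))

module PowerSums {c ℓ : Level} (S : CommutativeRing c ℓ) where
  open CommutativeRing S
  open IntegerImage S using (ι)
  open InRing S using (powR)
  open SeriesRing S
  open Syntax
  open ListSums S using (∑)
  open ListSums seriesRing using (∏)

  ∏-linear-s₀ : ∀ {X : Set} (F : X → Carrier) xs → s₀ (∏[ v ∈ xs ] linear (F v)) ≈ 1#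
  ∏-linear-s₀ F []       = refl
  ∏-linear-s₀ F (v ∷ xs) = trans (*-identityˡ _) (∏-linear-s₀ F xs)

  ≈-leading1 : ∀ {x} → s₀ x ≈ 1# → x ≈ₛ leading1 x
  ≈-leading1 s₀x≈1 = ≈-series s₀x≈1 refl refl refl refl refl

  module _ (N : Series Carrier → Carrier) (k : ℕ)
           (N-cong : ∀ {x y} → x ≈ₛ y → N x ≈ N y)
           (N-1 : N 1ₛ ≈ 0#)
           (N-* : ∀ x y → N (leading1 x *ₛ leading1 y) ≈ N x + N y)
           (N-linear : ∀ a → N (linear a) ≈ powR a k) where

    N-∏-linear : ∀ {X : Set} (F : X → Carrier) xs → N (∏[ v ∈ xs ] linear (F v)) ≈ ∑[ v ∈ xs ] powR (F v) k
    N-∏-linear F []       = N-1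
    N-∏-linear F (v ∷ xs) = begin
      N (linear (F v) *ₛ P)                    ≈⟨ N-cong (*ₛ-cong ≈ₛ-refl (≈-leading1 (∏-linear-s₀ F xs))) ⟩
      N (leading1 (linear (F v)) *ₛ leading1 P) ≈⟨ N-* (linear (F v)) P ⟩
      N (linear (F v)) + N P                   ≈⟨ +-cong (N-linear (F v)) (N-∏-linear F xs) ⟩
      powR (F v) k + ∑[ v ∈ xs ] powR (F v) k  ∎
      where
      open import Relation.Binary.Reasoning.Setoid setoid
      P : Series Carrier
      P = ∏[ v ∈ xs ] linear (F v)

  private
    infixl 6 _⊕_ _⊖_
    infixl 7 _⊛_
    _⊕_ : ∀ {a a′ b b′} → a ≈ a′ → b ≈ b′ → a + b ≈ a′ + b′
    _⊕_ = +-cong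
    _⊖_ : ∀ {a a′ b b′} → a ≈ a′ → b ≈ b′ → a - b ≈ a′ - b′
    a≈a′ ⊖ b≈b′ = +-cong a≈a′ (-‿cong b≈b′)
    _⊛_ : ∀ {a a′ b b′} → a ≈ a′ → b ≈ b′ → a * b ≈ a′ * b′
    _⊛_ = *-cong

  newton₄-cong : ∀ {x y} → x ≈ₛ y → newton₄ x ≈ newton₄ y
  newton₄-cong (≈-series _ e₁ e₂ e₃ e₄ _) =
    e₁ ⊛ e₁ ⊛ e₁ ⊛ e₁ ⊖ refl ⊛ (e₁ ⊛ e₁ ⊛ e₂) ⊕ refl ⊛ (e₁ ⊛ e₃) ⊕ refl ⊛ (e₂ ⊛ e₂) ⊖ refl ⊛ e₄

  newton₅-cong : ∀ {x y} → x ≈ₛ y → newton₅ x ≈ newton₅ y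
  newton₅-cong (≈-series _ e₁ e₂ e₃ e₄ e₅) =
    -‿cong (e₁ ⊛ e₁ ⊛ e₁ ⊛ e₁ ⊛ e₁) ⊕ refl ⊛ (e₁ ⊛ e₁ ⊛ e₁ ⊛ e₂) ⊖ refl ⊛ (e₁ ⊛ e₁ ⊛ e₃)
      ⊖ refl ⊛ (e₁ ⊛ e₂ ⊛ e₂) ⊕ refl ⊛ (e₁ ⊛ e₄) ⊕ refl ⊛ (e₂ ⊛ e₃) ⊖ refl ⊛ e₅

  newton₄-1 : newton₄ 1ₛ ≈ 0#
  newton₄-1 = prove [] [] (λ where [] [] → :newton₄ :1ₛ , con (+ 0)) ≡.refl

  newton₅-1 : newton₅ 1ₛ ≈ 0#
  newton₅-1 = prove [] [] (λ where [] [] → :newton₅ :1ₛ , con (+ 0)) ≡.refl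

  newton₄-* : ∀ x y → newton₄ (leading1 x *ₛ leading1 y) ≈ newton₄ x + newton₄ y
  newton₄-* x y = prove (x ∷ y ∷ []) [] (λ where
    (X ∷ Y ∷ []) [] → :newton₄ (:leading1 X :*ₛ :leading1 Y) , :newton₄ X :+ :newton₄ Y) ≡.refl

  newton₅-* : ∀ x y → newton₅ (leading1 x *ₛ leading1 y) ≈ newton₅ x + newton₅ y
  newton₅-* x y = prove (x ∷ y ∷ []) [] (λ where
    (X ∷ Y ∷ []) [] → :newton₅ (:leading1 X :*ₛ :leading1 Y) , :newton₅ X :+ :newton₅ Y) ≡.refl

  newton₄-linear : ∀ a → newton₄ (linear a) ≈ powR a 4
  newton₄-linear a = prove [] (a ∷ []) (λ where
    [] (A ∷ []) → :newton₄ (:linear A) , A :* (A :* (A :* (A :* con (+ 1))))) ≡.refl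

  newton₅-linear : ∀ a → newton₅ (linear a) ≈ powR a 5
  newton₅-linear a = prove [] (a ∷ []) (λ where
    [] (A ∷ []) → :newton₅ (:linear A) , A :* (A :* (A :* (A :* (A :* con (+ 1)))))) ≡.refl

  newton₄-∏-linear : ∀ {X : Set} (F : X → Carrier) xs → newton₄ (∏[ v ∈ xs ] linear (F v)) ≈ ∑[ v ∈ xs ] powR (F v) 4
  newton₄-∏-linear = N-∏-linear newton₄ 4 newton₄-cong newton₄-1 newton₄-* newton₄-linear

  newton₅-∏-linear : ∀ {X : Set} (F : X → Carrier) xs → newton₅ (∏[ v ∈ xs ] linear (F v)) ≈ ∑[ v ∈ xs ] powR (F v) 5
  newton₅-∏-linear = N-∏-linear newton₅ 5 newton₅-cong newton₅-1 newton₅-* newton₅-linear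

  newton₄-remainder : ∀ a b c e p q →
    newton₄ (1ₛ +ₛ series 0# 0# a b c e +ₛ series 0# 0# 0# 0# p q) ≈ ι (+ 2) * (a * a) - ι (+ 4) * (c + p)
  newton₄-remainder a b c e p q = prove [] (a ∷ b ∷ c ∷ e ∷ p ∷ q ∷ []) (λ where
    [] (A ∷ B ∷ C ∷ D ∷ P ∷ Q ∷ []) → :newton₄ (:1ₛ :+ₛ series :0 :0 A B C D :+ₛ series :0 :0 :0 :0 P Q) ,
                                      con (+ 2) :* (A :* A) :- con (+ 4) :* (C :+ P)) ≡.refl
    where
    :0 : ∀ {k} → Polynomial k
    :0 = con (+ 0)

  newton₅-remainder : ∀ a b c e p q →
    newton₅ (1ₛ +ₛ series 0# 0# a b c e +ₛ series 0# 0# 0# 0# p q) ≈ ι (+ 5) * (a * b) - ι (+ 5) * (e + q)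
  newton₅-remainder a b c e p q = prove [] (a ∷ b ∷ c ∷ e ∷ p ∷ q ∷ []) (λ where
    [] (A ∷ B ∷ C ∷ D ∷ P ∷ Q ∷ []) → :newton₅ (:1ₛ :+ₛ series :0 :0 A B C D :+ₛ series :0 :0 :0 :0 P Q) ,
                                      con (+ 5) :* (A :* B) :- con (+ 5) :* (D :+ Q)) ≡.refl
    where
    :0 : ∀ {k} → Polynomial k
    :0 = con (+ 0)

module SublistSums {c ℓ : Level} (S : CommutativeRing c ℓ) where
  open CommutativeRing S
  open SeriesRing S
  open Syntax
  open ListSums seriesRing
  module ℛ = ListSums S

  t²∣_ : Series Carrier → Set ℓ
  t²∣ x = (s₀ x ≈ 0#) × (s₁ x ≈ 0#)

  infix 4 _≈[t²]_ _≈[t⁴]_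
  record _≈[t²]_ (x y : Series Carrier) : Set ℓ where
    constructor mod-t²
    field truncate₂-≈ : truncate₂ x ≈ₛ truncate₂ y

  record _≈[t⁴]_ (x y : Series Carrier) : Set ℓ where
    constructor mod-t⁴
    field truncate₄-≈ : truncate₄ x ≈ₛ truncate₄ y

  ≈[t²]-trans : ∀ {x y z} → x ≈[t²] y → y ≈[t²] z → x ≈[t²] z
  ≈[t²]-trans (mod-t² x≈y) (mod-t² y≈z) = mod-t² (≈ₛ-trans x≈y y≈z)

  ≈[t⁴]-trans : ∀ {x y z} → x ≈[t⁴] y → y ≈[t⁴] z → x ≈[t⁴] z
  ≈[t⁴]-trans (mod-t⁴ x≈y) (mod-t⁴ y≈z) = mod-t⁴ (≈ₛ-trans x≈y y≈z)

  ≈[t⁴]-sym : ∀ {x y} → x ≈[t⁴] y → y ≈[t⁴] x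
  ≈[t⁴]-sym (mod-t⁴ x≈y) = mod-t⁴ (≈ₛ-sym x≈y)

  ≈ₛ⇒≈[t²] : ∀ {x y} → x ≈ₛ y → x ≈[t²] y
  ≈ₛ⇒≈[t²] (≈-series e₀ e₁ _ _ _ _) = mod-t² (≈-series e₀ e₁ refl refl refl refl)

  ≈ₛ⇒≈[t⁴] : ∀ {x y} → x ≈ₛ y → x ≈[t⁴] y
  ≈ₛ⇒≈[t⁴] (≈-series e₀ e₁ e₂ e₃ _ _) = mod-t⁴ (≈-series e₀ e₁ e₂ e₃ refl refl)

  +ₛ-cong[t²] : ∀ {x x′ y y′} → x ≈[t²] x′ → y ≈[t²] y′ → x +ₛ y ≈[t²] x′ +ₛ y′
  +ₛ-cong[t²] (mod-t² (≈-series e₀ e₁ _ _ _ _)) (mod-t² (≈-series f₀ f₁ _ _ _ _)) =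
    mod-t² (≈-series (+-cong e₀ f₀) (+-cong e₁ f₁) refl refl refl refl)

  +ₛ-cong[t⁴] : ∀ {x x′ y y′} → x ≈[t⁴] x′ → y ≈[t⁴] y′ → x +ₛ y ≈[t⁴] x′ +ₛ y′
  +ₛ-cong[t⁴] (mod-t⁴ (≈-series e₀ e₁ e₂ e₃ _ _)) (mod-t⁴ (≈-series f₀ f₁ f₂ f₃ _ _)) =
    mod-t⁴ (≈-series (+-cong e₀ f₀) (+-cong e₁ f₁) (+-cong e₂ f₂) (+-cong e₃ f₃) refl refl)

  -- Multiplying by a multiple of t² gains two orders of precision.
  module _ {w : Series Carrier} (t²∣w : t²∣ w) where

    private
      w′ : Series Carrier
      w′ = series 0# 0# (s₂ w) (s₃ w) (s₄ w) (s₅ w)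

      w*≈w′* : ∀ z → w *ₛ z ≈ₛ w′ *ₛ z
      w*≈w′* z = *ₛ-cong (≈-series (proj₁ t²∣w) (proj₂ t²∣w) refl refl refl refl) (≈ₛ-refl {z})

      W′ : ∀ {k} → Series (Polynomial k) → Series (Polynomial k)
      W′ W = series (con (+ 0)) (con (+ 0)) (s₂ W) (s₃ W) (s₄ W) (s₅ W)

    t²∣-*≈[t²]0 : ∀ x → w *ₛ x ≈[t²] 0ₛ
    t²∣-*≈[t²]0 x = ≈[t²]-trans (≈ₛ⇒≈[t²] (w*≈w′* x))
      (mod-t² (proveₛ (w ∷ x ∷ []) [] (λ where (W ∷ X ∷ []) [] → :truncate₂ (W′ W :*ₛ X) , :0ₛ) ≡.refl))

    t²∣-*-cong[t²] : ∀ {x y} → x ≈[t²] y → w *ₛ x ≈[t⁴] w *ₛ y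
    t²∣-*-cong[t²] {x} {y} (mod-t² x≈y) = ≈[t⁴]-trans (≈ₛ⇒≈[t⁴] (w*≈w′* x)) (≈[t⁴]-trans (only-low x)
      (≈[t⁴]-trans (≈ₛ⇒≈[t⁴] (*ₛ-cong (≈ₛ-refl {w′}) x≈y)) (≈[t⁴]-sym (≈[t⁴]-trans (≈ₛ⇒≈[t⁴] (w*≈w′* y)) (only-low y)))))
      where
      only-low : ∀ z → w′ *ₛ z ≈[t⁴] w′ *ₛ truncate₂ z
      only-low z = mod-t⁴ (proveₛ (w ∷ z ∷ []) [] (λ where
        (W ∷ Z ∷ []) [] → :truncate₄ (W′ W :*ₛ Z) , :truncate₄ (W′ W :*ₛ :truncate₂ Z)) ≡.refl)

    t²∣-*-cong[t⁴] : ∀ {x y} → x ≈[t⁴] y → w *ₛ x ≈ₛ w *ₛ y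
    t²∣-*-cong[t⁴] {x} {y} (mod-t⁴ x≈y) = ≈ₛ-trans (w*≈w′* x) (≈ₛ-trans (only-low x)
      (≈ₛ-trans (*ₛ-cong (≈ₛ-refl {w′}) x≈y) (≈ₛ-sym (≈ₛ-trans (w*≈w′* y) (only-low y)))))
      where
      only-low : ∀ z → w′ *ₛ z ≈ₛ w′ *ₛ truncate₄ z
      only-low z = proveₛ (w ∷ z ∷ []) [] (λ where
        (W ∷ Z ∷ []) [] → W′ W :*ₛ Z , W′ W :*ₛ :truncate₄ Z) ≡.refl

  ∑ₛ-coefficients : ∀ {X : Set} (f : X → Series Carrier) xs →
    ∑ f xs ≈ₛ series (ℛ.∑[ x ∈ xs ] s₀ (f x)) (ℛ.∑[ x ∈ xs ] s₁ (f x)) (ℛ.∑[ x ∈ xs ] s₂ (f x))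
                     (ℛ.∑[ x ∈ xs ] s₃ (f x)) (ℛ.∑[ x ∈ xs ] s₄ (f x)) (ℛ.∑[ x ∈ xs ] s₅ (f x))
  ∑ₛ-coefficients f []       = ≈ₛ-refl
  ∑ₛ-coefficients f (x ∷ xs) = +ₛ-cong (≈ₛ-refl {f x}) (∑ₛ-coefficients f xs)

  module _ {X : Set} (w : X → Series Carrier) (t²∣w : ∀ x → t²∣ w x) where
    open import Relation.Binary.Reasoning.Setoid (CommutativeRing.setoid seriesRing)
    open import Algebra.Solver.CommutativeMonoid (CommutativeRing.+-commutativeMonoid seriesRing)
      using (solve; _⊕_; _⊜_)

    sublistSum : (List X → Bool) → List X → Series Carrier
    sublistSum P xs = ∑[ ys ∈ sublists xs ] (if P ys then ∏ w ys else 0ₛ)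

    constantTerm : (List X → Bool) → Series Carrier
    constantTerm P = if P [] then 1ₛ else 0ₛ

    linearTerms : (List X → Bool) → List X → Series Carrier
    linearTerms P xs = ∑[ x ∈ xs ] (if P (x ∷ []) then w x else 0ₛ)

    quadraticTerms : (List X → Bool) → List X → Series Carrier
    quadraticTerms P []       = 0ₛ
    quadraticTerms P (x ∷ xs) = ∑[ y ∈ xs ] (if P (x ∷ y ∷ []) then w x *ₛ w y else 0ₛ) +ₛ quadraticTerms P xs

    private
      *ₛ-if : ∀ b y z → y *ₛ (if b then z else 0ₛ) ≈ₛ (if b then y *ₛ z else 0ₛ)
      *ₛ-if true  y z = ≈ₛ-refl
      *ₛ-if false y z = *ₛ-zeroʳ y

      *ₛ-indicator : ∀ b y → y *ₛ (if b then 1ₛ else 0ₛ) ≈ₛ (if b then y else 0ₛ)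
      *ₛ-indicator true  y = *ₛ-identityʳ y
      *ₛ-indicator false y = *ₛ-zeroʳ y

    sublistSum-∷ : ∀ P x xs → sublistSum P (x ∷ xs) ≈ₛ sublistSum P xs +ₛ w x *ₛ sublistSum (P ∘ (x ∷_)) xs
    sublistSum-∷ P x xs = ≈ₛ-trans (∑-++ f (sublists xs) (List.map (x ∷_) (sublists xs))) (+ₛ-cong ≈ₛ-refl (begin
      ∑ f (List.map (x ∷_) (sublists xs))                                       ≡⟨ ∑-map f (x ∷_) (sublists xs) ⟩
      ∑[ ys ∈ sublists xs ] f (x ∷ ys)
        ≈⟨ ∑-cong (λ ys → *ₛ-if (P (x ∷ ys)) (w x) (∏ w ys)) (sublists xs) ⟨
      ∑[ ys ∈ sublists xs ] (w x *ₛ (if P (x ∷ ys) then ∏ w ys else 0ₛ))       ≈⟨ *-distribˡ-∑ (w x) _ (sublists xs) ⟩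
      w x *ₛ sublistSum (P ∘ (x ∷_)) xs                                         ∎))
      where
      f : List X → Series Carrier
      f ys = if P ys then ∏ w ys else 0ₛ

    sublistSum-≈[t²] : ∀ P xs → sublistSum P xs ≈[t²] constantTerm P
    sublistSum-≈[t²] P []       = ≈ₛ⇒≈[t²] (+ₛ-identityʳ _)
    sublistSum-≈[t²] P (x ∷ xs) = ≈[t²]-trans (≈ₛ⇒≈[t²] (sublistSum-∷ P x xs))
      (≈[t²]-trans (+ₛ-cong[t²] (sublistSum-≈[t²] P xs) (t²∣-*≈[t²]0 (t²∣w x) _)) (≈ₛ⇒≈[t²] (+ₛ-identityʳ _)))

    sublistSum-≈[t⁴] : ∀ P xs → sublistSum P xs ≈[t⁴] constantTerm P +ₛ linearTerms P xs
    sublistSum-≈[t⁴] P []       = ≈ₛ⇒≈[t⁴] ≈ₛ-refl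
    sublistSum-≈[t⁴] P (x ∷ xs) = ≈[t⁴]-trans (≈ₛ⇒≈[t⁴] (sublistSum-∷ P x xs))
      (≈[t⁴]-trans (+ₛ-cong[t⁴] (sublistSum-≈[t⁴] P xs) (t²∣-*-cong[t²] (t²∣w x) (sublistSum-≈[t²] (P ∘ (x ∷_)) xs)))
      (≈ₛ⇒≈[t⁴] (≈ₛ-trans (+ₛ-cong ≈ₛ-refl (*ₛ-indicator (P (x ∷ [])) (w x)))
        (rearrange (constantTerm P) (linearTerms P xs) (if P (x ∷ []) then w x else 0ₛ)))))
      where
      rearrange : ∀ c l b → (c +ₛ l) +ₛ b ≈ₛ c +ₛ (b +ₛ l)
      rearrange = solve 3 (λ c l b → (c ⊕ l) ⊕ b ⊜ c ⊕ (b ⊕ l)) ≈ₛ-refl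

    sublistSum-expansion : ∀ P xs → sublistSum P xs ≈ₛ constantTerm P +ₛ linearTerms P xs +ₛ quadraticTerms P xs
    sublistSum-expansion P []       = ≈ₛ-sym (+ₛ-identityʳ _)
    sublistSum-expansion P (x ∷ xs) = begin
      sublistSum P (x ∷ xs)                      ≈⟨ sublistSum-∷ P x xs ⟩
      sublistSum P xs +ₛ w x *ₛ sublistSum P′ xs ≈⟨ +ₛ-cong (sublistSum-expansion P xs)
                                                          (t²∣-*-cong[t⁴] (t²∣w x) (sublistSum-≈[t⁴] P′ xs)) ⟩
      (u +ₛ l +ₛ q) +ₛ w x *ₛ (constantTerm P′ +ₛ linearTerms P′ xs)
                                                 ≈⟨ +ₛ-cong ≈ₛ-refl (*ₛ-distribˡ (w x) _ _) ⟩
      (u +ₛ l +ₛ q) +ₛ (w x *ₛ constantTerm P′ +ₛ w x *ₛ linearTerms P′ xs)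
                                                 ≈⟨ +ₛ-cong ≈ₛ-refl (+ₛ-cong (*ₛ-indicator (P (x ∷ [])) (w x)) pairs-with-x) ⟩
      (u +ₛ l +ₛ q) +ₛ (b +ₛ Q)                  ≈⟨ rearrange u l q b Q ⟩
      u +ₛ (b +ₛ l) +ₛ (Q +ₛ q)                  ∎
      where
      P′ : List X → Bool
      P′ = P ∘ (x ∷_)
      u l q b Q : Series Carrier
      u = constantTerm P
      l = linearTerms P xs
      q = quadraticTerms P xs
      b = if P (x ∷ []) then w x else 0ₛ
      Q = ∑[ y ∈ xs ] (if P (x ∷ y ∷ []) then w x *ₛ w y else 0ₛ)
      pairs-with-x : w x *ₛ linearTerms P′ xs ≈ₛ Q
      pairs-with-x = ≈ₛ-trans (≈ₛ-sym (*-distribˡ-∑ (w x) _ xs)) (∑-cong (λ y → *ₛ-if (P (x ∷ y ∷ [])) (w x) (w y)) xs)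
      rearrange : ∀ u l q b Q → (u +ₛ l +ₛ q) +ₛ (b +ₛ Q) ≈ₛ u +ₛ (b +ₛ l) +ₛ (Q +ₛ q)
      rearrange = solve 5 (λ u l q b Q → ((u ⊕ l) ⊕ q) ⊕ (b ⊕ Q) ⊜ (u ⊕ (b ⊕ l)) ⊕ (Q ⊕ q)) ≈ₛ-refl

module SeriesHomomorphism {a ℓa c ℓ : Level} (A : RawRing a ℓa) (ιᴬ : ℤ → RawRing.Carrier A)
  (B : CommutativeRing c ℓ) (ιᴮ : ℤ → CommutativeRing.Carrier B) where
  private
    module A = RawRing A
    module 𝐀 = SeriesOps A ιᴬ
  open CommutativeRing B
  private
    module 𝐁 = SeriesOps rawRing ιᴮ

  module Along (h : A.Carrier → Carrier)
    (h-+ : ∀ x y → h (x A.+ y) ≈ h x + h y) (h-* : ∀ x y → h (x A.* y) ≈ h x * h y)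
    (h-‿ : ∀ x → h (A.- x) ≈ - h x) (h-ι : ∀ k → h (ιᴬ k) ≈ ιᴮ k) where

    private
      infixl 6 _⊞_ _⊟_
      infixl 7 _⊠_
      _⊞_ : ∀ {x y a b} → h x ≈ a → h y ≈ b → h (x A.+ y) ≈ a + b
      _⊞_ {x} {y} x≈a y≈b = trans (h-+ x y) (+-cong x≈a y≈b)
      _⊠_ : ∀ {x y a b} → h x ≈ a → h y ≈ b → h (x A.* y) ≈ a * b
      _⊠_ {x} {y} x≈a y≈b = trans (h-* x y) (*-cong x≈a y≈b)
      _⊟_ : ∀ {x y a b} → h x ≈ a → h y ≈ b → h (x 𝐀.- y) ≈ a - b
      _⊟_ {y = y} x≈a y≈b = x≈a ⊞ trans (h-‿ y) (-‿cong y≈b)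

    newton₄-homo : ∀ x → h (𝐀.newton₄ x) ≈ 𝐁.newton₄ (mapₛ h x)
    newton₄-homo x =
      r ⊠ r ⊠ r ⊠ r ⊟ h-ι (+ 4) ⊠ (r ⊠ r ⊠ r) ⊞ h-ι (+ 4) ⊠ (r ⊠ r) ⊞ h-ι (+ 2) ⊠ (r ⊠ r) ⊟ h-ι (+ 4) ⊠ r
      where
      r : ∀ {y} → h y ≈ h y
      r = refl

    newton₅-homo : ∀ x → h (𝐀.newton₅ x) ≈ 𝐁.newton₅ (mapₛ h x)
    newton₅-homo x =
      trans (h-‿ _) (-‿cong (r ⊠ r ⊠ r ⊠ r ⊠ r)) ⊞ h-ι (+ 5) ⊠ (r ⊠ r ⊠ r ⊠ r) ⊟ h-ι (+ 5) ⊠ (r ⊠ r ⊠ r)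
        ⊟ h-ι (+ 5) ⊠ (r ⊠ r ⊠ r) ⊞ h-ι (+ 5) ⊠ (r ⊠ r) ⊞ h-ι (+ 5) ⊠ (r ⊠ r) ⊟ h-ι (+ 5) ⊠ r
      where
      r : ∀ {y} → h y ≈ h y
      r = refl

module Roots {c ℓ : Level} (R : CommutativeRing c ℓ) where
  open CommutativeRing R
  open InRing R using (fromℤ; rootPoly; AreRootsOf; powerSum; mulR; coeffR)
  open IntegerImage R
  open SeriesRing R
  open Reversal R
  open PowerSums R
  open ListSums seriesRing using (∏)
  open import Relation.Binary.Reasoning.Setoid setoid
  module ℤₛ = SeriesRing ℤ-ring
  module ℤReversal = Reversal ℤ-ring

  reversed-rootPoly : ∀ n (λs : Fin n → Carrier) → reversed n (rootPoly λs) ≈ₛ ∏[ i ∈ List.allFin n ] linear (λs i)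
  reversed-rootPoly n λs =
    ≡.subst (λ is → reversed n (foldr mulR (1# ∷ []) (List.map (λ i → - λs i ∷ 1# ∷ []) is)) ≈ₛ
                    ∏[ i ∈ List.allFin n ] linear (λs i))
            (List.filter-all (λ _ → T? true) (All.universal (λ _ → tt) (List.allFin n)))
            (reversed-linearProduct-allFin (λ _ → true) λs)

  topCoeff-fromℤ : ∀ (p : List Carrier) (q : List ℤ) → (∀ k → coeffR p k ≈ fromℤ (InRing.coeffR ℤ-ring q k)) →
                   ∀ N j → topCoeff N p j ≈ fromℤ (ℤReversal.topCoeff N q j)
  topCoeff-fromℤ p q p≈q N       zero    = p≈q N
  topCoeff-fromℤ p q p≈q zero    (suc j) = refl
  topCoeff-fromℤ p q p≈q (suc N) (suc j) = topCoeff-fromℤ p q p≈q N j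

  reversed-fromℤ : ∀ (p : List Carrier) (q : List ℤ) → (∀ k → coeffR p k ≈ fromℤ (InRing.coeffR ℤ-ring q k)) →
                   ∀ N → reversed N p ≈ₛ mapₛ fromℤ (ℤReversal.reversed N q)
  reversed-fromℤ p q p≈q N = ≈-series
    (topCoeff-fromℤ p q p≈q N 0) (topCoeff-fromℤ p q p≈q N 1) (topCoeff-fromℤ p q p≈q N 2)
    (topCoeff-fromℤ p q p≈q N 3) (topCoeff-fromℤ p q p≈q N 4) (topCoeff-fromℤ p q p≈q N 5)

  private
    fromℤ-ι : ∀ k → fromℤ (IntegerImage.ι ℤ-ring k) ≈ ι k
    fromℤ-ι k = trans (reflexive (≡.cong fromℤ (ι-ℤ≡id k))) (sym (ι≈fromℤ k))

  open SeriesHomomorphism.Along (CommutativeRing.rawRing ℤ-ring) (IntegerImage.ι ℤ-ring) R ι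
    fromℤ fromℤ-homo-+ fromℤ-homo-* fromℤ-homo‿- fromℤ-ι using (newton₄-homo; newton₅-homo)

  module _ {n} (q : List ℤ) (λs : Fin n → Carrier) (roots : AreRootsOf q λs) where

    reversed-roots : reversed n (rootPoly λs) ≈ₛ mapₛ fromℤ (ℤReversal.reversed n q)
    reversed-roots = reversed-fromℤ (rootPoly λs) q roots n

    powerSum₄-roots : powerSum λs 4 ≈ fromℤ (ℤₛ.newton₄ (ℤReversal.reversed n q))
    powerSum₄-roots = begin
      powerSum λs 4                                 ≈⟨ newton₄-∏-linear λs (List.allFin n) ⟨
      newton₄ (∏[ i ∈ List.allFin n ] linear (λs i)) ≈⟨ newton₄-cong (reversed-rootPoly n λs) ⟨
      newton₄ (reversed n (rootPoly λs))            ≈⟨ newton₄-cong reversed-roots ⟩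
      newton₄ (mapₛ fromℤ (ℤReversal.reversed n q))  ≈⟨ newton₄-homo (ℤReversal.reversed n q) ⟨
      fromℤ (ℤₛ.newton₄ (ℤReversal.reversed n q))    ∎

    powerSum₅-roots : powerSum λs 5 ≈ fromℤ (ℤₛ.newton₅ (ℤReversal.reversed n q))
    powerSum₅-roots = begin
      powerSum λs 5                                 ≈⟨ newton₅-∏-linear λs (List.allFin n) ⟨
      newton₅ (∏[ i ∈ List.allFin n ] linear (λs i)) ≈⟨ newton₅-cong (reversed-rootPoly n λs) ⟨
      newton₅ (reversed n (rootPoly λs))            ≈⟨ newton₅-cong reversed-roots ⟩
      newton₅ (mapₛ fromℤ (ℤReversal.reversed n q))  ≈⟨ newton₅-homo (ℤReversal.reversed n q) ⟨
      fromℤ (ℤₛ.newton₅ (ℤReversal.reversed n q))    ∎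

All-sublists : ∀ {X : Set} {P : X → Set} {xs} → All P xs → All (All P) (sublists xs)
All-sublists []         = [] ∷ []
All-sublists (px ∷ pxs) = All.++⁺ (All-sublists pxs) (All.map⁺ (All.map (px ∷_) (All-sublists pxs)))

module EdgeFacts {n : ℕ} (G : Graph n) where

  Ordered : Fin n → Fin n → Bool
  Ordered i j = (toℕ i ℕ.<ᵇ toℕ j) ∧ adj G i j

  IsEdge : Fin n × Fin n → Set
  IsEdge (i , j) = T (Ordered i j)

  edges-ordered : All IsEdge (edges G)
  edges-ordered = All.concat⁺ (All.map⁺ (All.universal (λ i →
                  All.concat⁺ (All.map⁺ (All.universal (ordered-single i) (List.allFin n)))) (List.allFin n)))
    where
    ordered-single : ∀ i j → All IsEdge (if Ordered i j then (i , j) ∷ [] else [])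
    ordered-single i j with Ordered i j in ordered
    ... | true  = ≡.subst T (≡.sym ordered) tt ∷ []
    ... | false = []

  edge-adjacent : ∀ {i j} → IsEdge (i , j) → adj G i j ≡ true
  edge-adjacent e = Equivalence.to Bool.T-≡ (proj₂ (Equivalence.to Bool.T-∧ e))

  edge-distinct : ∀ {i j} → IsEdge (i , j) → i ≢ j
  edge-distinct {i} e ≡.refl = ℕ.<-irrefl ≡.refl (ℕ.<ᵇ⇒< (toℕ i) (toℕ i) (proj₁ (Equivalence.to Bool.T-∧ e)))

module DegreeCounting {n : ℕ} (G : Graph n) where
  open ListSums ℤ-ring
  open InRing ℤ-ring using (powR)
  open EdgeFacts G
  open import Data.Integer using (_+_; _*_; _-_; -_)
  open import Data.Integer.Tactic.RingSolver using (solve-∀)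
  open ≡.≡-Reasoning

  V : List (Fin n)
  V = List.allFin n

  E : List (Fin n × Fin n)
  E = edges G

  m : ℤ
  m = + List.length E

  d : Fin n → ℤ
  d v = + deg G v

  𝟙 : Bool → ℤ
  𝟙 b = if b then + 1 else + 0

  𝟙-* : ∀ b a → 𝟙 b * a ≡ (if b then a else + 0)
  𝟙-* true  a = ℤ.*-identityˡ a
  𝟙-* false a = ≡.refl

  +-∑ : ∀ {X : Set} (f : X → ℕ) xs → + (foldr ℕ._+_ 0 (List.map f xs)) ≡ ∑[ x ∈ xs ] (+ f x)
  +-∑ f []       = ≡.refl
  +-∑ f (x ∷ xs) = ≡.trans (ℤ.pos-+ (f x) _) (≡.cong (λ s → + f x + s) (+-∑ f xs))

  ∑-const : ∀ {X : Set} c (xs : List X) → ∑[ x ∈ xs ] c ≡ c * + List.length xs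
  ∑-const c []       = ≡.sym (ℤ.*-zeroʳ c)
  ∑-const c (x ∷ xs) = ≡.trans (≡.cong (λ s → c + s) (∑-const c xs)) (step c (+ List.length xs))
    where
    step : ∀ c k → c + c * k ≡ c * (+ 1 + k)
    step = solve-∀

  degree-∑ : ∀ v → d v ≡ ∑[ j ∈ V ] 𝟙 (adj G v j)
  degree-∑ v = ≡.trans (+-∑ _ V) (∑-cong (λ j → +-if (adj G v j)) V)
    where
    +-if : ∀ b → + (if b then 1 else 0) ≡ 𝟙 b
    +-if true  = ≡.refl
    +-if false = ≡.refl

  ∑-edges : ∀ (Φ : Fin n × Fin n → ℤ) → ∑ Φ E ≡ ∑[ i ∈ V ] ∑[ j ∈ V ] (if Ordered i j then Φ (i , j) else + 0)
  ∑-edges Φ = ≡.trans (∑-concatMap Φ _ V)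
    (∑-cong (λ i → ≡.trans (∑-concatMap Φ _ V) (∑-cong (λ j → ∑-singleton (Ordered i j) (i , j)) V)) V)
    where
    ∑-singleton : ∀ b e → ∑ Φ (if b then e ∷ [] else []) ≡ (if b then Φ e else + 0)
    ∑-singleton true  e = ℤ.+-identityʳ (Φ e)
    ∑-singleton false e = ≡.refl

  ordered-either-way : ∀ i j a → (if Ordered i j then a else + 0) + (if Ordered j i then a else + 0) ≡ 𝟙 (adj G i j) * a
  ordered-either-way i j a rewrite Graph.sym G j i
    with toℕ i ℕ.<ᵇ toℕ j in i<j | toℕ j ℕ.<ᵇ toℕ i in j<i | adj G i j in i~j
  ... | true  | true  | _     = contradiction (ℕ.<ᵇ⇒< (toℕ j) (toℕ i) (≡.subst T (≡.sym j<i) tt))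
                                              (ℕ.<⇒≯ (ℕ.<ᵇ⇒< (toℕ i) (toℕ j) (≡.subst T (≡.sym i<j) tt)))
  ... | true  | false | true  = ≡.trans (ℤ.+-identityʳ a) (≡.sym (ℤ.*-identityˡ a))
  ... | true  | false | false = ≡.refl
  ... | false | true  | true  = ≡.trans (ℤ.+-identityˡ a) (≡.sym (ℤ.*-identityˡ a))
  ... | false | true  | false = ≡.refl
  ... | false | false | false = ≡.refl
  ... | false | false | true  with ℕ.<-cmp (toℕ i) (toℕ j)
  ...   | tri< i<j′ _ _ = contradiction (≡.subst T i<j (ℕ.<⇒<ᵇ i<j′)) id
  ...   | tri> _ _ j<i′ = contradiction (≡.subst T j<i (ℕ.<⇒<ᵇ j<i′)) id
  ...   | tri≈ _ i≡j _ with Data.Fin.Properties.toℕ-injective i≡j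
  ...     | ≡.refl = contradiction (≡.trans (≡.sym (Graph.irrefl G i)) i~j) (λ ())

  -- Each edge is listed once, as (i , j) with i < j.
  ∑-edges-sym : ∀ (h : Fin n → Fin n → ℤ) →
    ∑[ e ∈ E ] (h (proj₁ e) (proj₂ e) + h (proj₂ e) (proj₁ e)) ≡ ∑[ i ∈ V ] ∑[ j ∈ V ] (𝟙 (adj G i j) * h i j)
  ∑-edges-sym h = begin
    ∑[ e ∈ E ] (h (proj₁ e) (proj₂ e) + h (proj₂ e) (proj₁ e))
      ≡⟨ ∑-edges _ ⟩
    ∑[ i ∈ V ] ∑[ j ∈ V ] (if Ordered i j then h i j + h j i else + 0)
      ≡⟨ ∑-cong (λ i → ≡.trans (∑-cong (λ j → if-+ (Ordered i j) (h i j) (h j i)) V) (∑-distrib-+ _ _ V)) V ⟩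
    ∑[ i ∈ V ] (∑[ j ∈ V ] below i j + ∑[ j ∈ V ] above j i)
      ≡⟨ ∑-distrib-+ _ _ V ⟩
    ∑[ i ∈ V ] ∑[ j ∈ V ] below i j + ∑[ i ∈ V ] ∑[ j ∈ V ] above j i
      ≡⟨ ≡.cong (λ z → ∑[ i ∈ V ] ∑[ j ∈ V ] below i j + z) (∑-comm (λ i j → above j i) V V) ⟩
    ∑[ i ∈ V ] ∑[ j ∈ V ] below i j + ∑[ j ∈ V ] ∑[ i ∈ V ] above j i
      ≡⟨ ∑-distrib-+ _ _ V ⟨
    ∑[ i ∈ V ] (∑[ j ∈ V ] below i j + ∑[ j ∈ V ] above i j)
      ≡⟨ ∑-cong (λ i → ≡.trans (≡.sym (∑-distrib-+ _ _ V)) (∑-cong (λ j → ordered-either-way i j (h i j)) V)) V ⟩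
    ∑[ i ∈ V ] ∑[ j ∈ V ] (𝟙 (adj G i j) * h i j) ∎
    where
    below above : Fin n → Fin n → ℤ
    below i j = if Ordered i j then h i j else + 0
    above i j = if Ordered j i then h i j else + 0
    if-+ : ∀ b (a a′ : ℤ) → (if b then a + a′ else + 0) ≡ (if b then a else + 0) + (if b then a′ else + 0)
    if-+ true  a a′ = ≡.refl
    if-+ false a a′ = ≡.refl

  handshake : ∀ (g : Fin n → ℤ) → ∑[ e ∈ E ] (g (proj₁ e) + g (proj₂ e)) ≡ ∑[ v ∈ V ] (d v * g v)
  handshake g = ≡.trans (∑-edges-sym (λ i _ → g i))
    (∑-cong (λ i → ≡.trans (*-distribʳ-∑ (g i) (λ j → 𝟙 (adj G i j)) V) (≡.cong (_* g i) (≡.sym (degree-∑ i)))) V)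

  ∑-δ-* : ∀ x (F : Fin n → ℤ) → ∑[ i ∈ V ] (𝟙 (x == i) * F i) ≡ F x
  ∑-δ-* x F = ≡.trans (∑-cong (λ i → 𝟙-* (x == i) (F i)) V) (∑-δ x F)

  ∑-+-- : ∀ {X : Set} (f g h : X → ℤ) xs → ∑[ x ∈ xs ] (f x + g x - h x) ≡ ∑ f xs + ∑ g xs - ∑ h xs
  ∑-+-- f g h xs = ≡.trans (∑-distrib-+ (λ x → f x + g x) (λ x → - h x) xs)
                            (≡.cong₂ _+_ (∑-distrib-+ f g xs) (-‿distrib-∑ h xs))

  -- For i ≢ j, the indicator that (i , j) meets (x , y), split into a part
  -- for each orientation of (i , j).
  meets : Fin n → Fin n → Fin n → Fin n → ℤ
  meets x y i j = 𝟙 (x == i) + 𝟙 (y == i) - 𝟙 (x == i) * 𝟙 (y == j)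

  share-indicator : ∀ x y i j → x ≢ y → i ≢ j → 𝟙 (shareVertex (x , y) (i , j)) ≡ meets x y i j + meets x y j i
  share-indicator x y i j x≢y i≢j with x == i in x=i | x == j in x=j | y == i in y=i | y == j in y=j
  ... | true  | true  | _     | _     = contradiction (≡.trans (≡.sym (==⇒≡ x=i)) (==⇒≡ x=j)) i≢j
  ... | _     | _     | true  | true  = contradiction (≡.trans (≡.sym (==⇒≡ y=i)) (==⇒≡ y=j)) i≢j
  ... | true  | _     | true  | _     = contradiction (≡.trans (==⇒≡ x=i) (≡.sym (==⇒≡ y=i))) x≢y
  ... | _     | true  | _     | true  = contradiction (≡.trans (==⇒≡ x=j) (≡.sym (==⇒≡ y=j))) x≢y
  ... | true  | false | false | true  = ≡.refl
  ... | true  | false | false | false = ≡.refl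
  ... | false | true  | true  | false = ≡.refl
  ... | false | true  | false | false = ≡.refl
  ... | false | false | true  | false = ≡.refl
  ... | false | false | false | true  = ≡.refl
  ... | false | false | false | false = ≡.refl

  meets-row : ∀ x y i → ∑[ j ∈ V ] (𝟙 (adj G i j) * meets x y i j) ≡
              𝟙 (x == i) * d i + 𝟙 (y == i) * d i - 𝟙 (x == i) * ∑[ j ∈ V ] (𝟙 (y == j) * 𝟙 (adj G i j))
  meets-row x y i = begin
    ∑[ j ∈ V ] (𝟙 (adj G i j) * meets x y i j)
      ≡⟨ ∑-cong (λ j → expand (𝟙 (adj G i j)) (𝟙 (x == i)) (𝟙 (y == i)) (𝟙 (y == j))) V ⟩
    ∑[ j ∈ V ] (𝟙 (x == i) * 𝟙 (adj G i j) + 𝟙 (y == i) * 𝟙 (adj G i j) - 𝟙 (x == i) * (𝟙 (y == j) * 𝟙 (adj G i j)))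
      ≡⟨ ∑-+-- _ _ _ V ⟩
    ∑[ j ∈ V ] (𝟙 (x == i) * 𝟙 (adj G i j)) + ∑[ j ∈ V ] (𝟙 (y == i) * 𝟙 (adj G i j))
      - ∑[ j ∈ V ] (𝟙 (x == i) * (𝟙 (y == j) * 𝟙 (adj G i j)))
      ≡⟨ ≡.cong₂ _-_ (≡.cong₂ _+_ (*-distribˡ-∑ (𝟙 (x == i)) (𝟙 ∘ adj G i) V) (*-distribˡ-∑ (𝟙 (y == i)) (𝟙 ∘ adj G i) V))
                     (*-distribˡ-∑ (𝟙 (x == i)) (λ j → 𝟙 (y == j) * 𝟙 (adj G i j)) V) ⟩
    𝟙 (x == i) * ∑[ j ∈ V ] 𝟙 (adj G i j) + 𝟙 (y == i) * ∑[ j ∈ V ] 𝟙 (adj G i j)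
      - 𝟙 (x == i) * ∑[ j ∈ V ] (𝟙 (y == j) * 𝟙 (adj G i j))
      ≡⟨ ≡.cong (λ dᵢ → 𝟙 (x == i) * dᵢ + 𝟙 (y == i) * dᵢ - 𝟙 (x == i) * ∑[ j ∈ V ] (𝟙 (y == j) * 𝟙 (adj G i j)))
                (≡.sym (degree-∑ i)) ⟩
    𝟙 (x == i) * d i + 𝟙 (y == i) * d i - 𝟙 (x == i) * ∑[ j ∈ V ] (𝟙 (y == j) * 𝟙 (adj G i j)) ∎
    where
    expand : ∀ a p q r → a * (p + q - p * r) ≡ p * a + q * a - p * (r * a)
    expand = solve-∀

  meeting-count : ∀ {x y} → IsEdge (x , y) → ∑[ f ∈ E ] 𝟙 (shareVertex (x , y) f) ≡ d x + d y - + 1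
  meeting-count {x} {y} xy = begin
    ∑[ f ∈ E ] 𝟙 (shareVertex (x , y) f)
      ≡⟨ ∑-congᴬˡˡ (All.map (λ {f} f-edge → share-indicator x y (proj₁ f) (proj₂ f) (edge-distinct xy) (edge-distinct f-edge))
                            edges-ordered) ⟩
    ∑[ f ∈ E ] (meets x y (proj₁ f) (proj₂ f) + meets x y (proj₂ f) (proj₁ f))
      ≡⟨ ∑-edges-sym (meets x y) ⟩
    ∑[ i ∈ V ] ∑[ j ∈ V ] (𝟙 (adj G i j) * meets x y i j)
      ≡⟨ ∑-cong (meets-row x y) V ⟩
    ∑[ i ∈ V ] (𝟙 (x == i) * d i + 𝟙 (y == i) * d i - 𝟙 (x == i) * ∑[ j ∈ V ] (𝟙 (y == j) * 𝟙 (adj G i j)))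
      ≡⟨ ∑-+-- _ _ _ V ⟩
    ∑[ i ∈ V ] (𝟙 (x == i) * d i) + ∑[ i ∈ V ] (𝟙 (y == i) * d i)
      - ∑[ i ∈ V ] (𝟙 (x == i) * ∑[ j ∈ V ] (𝟙 (y == j) * 𝟙 (adj G i j)))
      ≡⟨ ≡.cong₂ _-_ (≡.cong₂ _+_ (∑-δ-* x d) (∑-δ-* y d))
                     (≡.trans (∑-δ-* x (λ i → ∑[ j ∈ V ] (𝟙 (y == j) * 𝟙 (adj G i j)))) (∑-δ-* y (𝟙 ∘ adj G x))) ⟩
    d x + d y - 𝟙 (adj G x y)
      ≡⟨ ≡.cong (λ b → d x + d y - 𝟙 b) (edge-adjacent xy) ⟩
    d x + d y - + 1 ∎

  degreeSum : Fin n × Fin n → ℤ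
  degreeSum (x , y) = d x + d y

  disjoint : Fin n × Fin n → Fin n × Fin n → Bool
  disjoint e f = not (shareVertex e f)

  disjoint-count : ∀ {e} → IsEdge e → ∑[ f ∈ E ] 𝟙 (disjoint e f) ≡ (m + + 1) - degreeSum e
  disjoint-count {x , y} xy = begin
    ∑[ f ∈ E ] 𝟙 (disjoint (x , y) f)                    ≡⟨ ∑-cong (λ f → 𝟙-not (shareVertex (x , y) f)) E ⟩
    ∑[ f ∈ E ] (+ 1 - 𝟙 (shareVertex (x , y) f))         ≡⟨ ∑-distrib-+ (λ _ → + 1) (λ f → - 𝟙 (shareVertex (x , y) f)) E ⟩
    ∑[ f ∈ E ] (+ 1) + ∑[ f ∈ E ] (- 𝟙 (shareVertex (x , y) f))
      ≡⟨ ≡.cong₂ _+_ (≡.trans (∑-const (+ 1) E) (ℤ.*-identityˡ m)) (-‿distrib-∑ _ E) ⟩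
    m - ∑[ f ∈ E ] 𝟙 (shareVertex (x , y) f)             ≡⟨ ≡.cong (λ k → m - k) (meeting-count xy) ⟩
    m - (d x + d y - + 1)                                ≡⟨ regroup m (d x) (d y) ⟩
    (m + + 1) - (d x + d y)                              ∎
    where
    𝟙-not : ∀ b → 𝟙 (not b) ≡ + 1 - 𝟙 b
    𝟙-not true  = ≡.refl
    𝟙-not false = ≡.refl
    regroup : ∀ m a b → m - (a + b - + 1) ≡ (m + + 1) - (a + b)
    regroup = solve-∀

  shareVertex-sym : ∀ (e f : Fin n × Fin n) → shareVertex e f ≡ shareVertex f e
  shareVertex-sym (i , j) (k , l)
    rewrite ==-sym k i | ==-sym k j | ==-sym l i | ==-sym l j = swap-middle (i == k) (i == l) (j == k) (j == l)
    where
    swap-middle : ∀ a b c e → (a ∨ b ∨ c ∨ e) ≡ (a ∨ c ∨ b ∨ e)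
    swap-middle true  b     c     e = ≡.refl
    swap-middle false true  true  e = ≡.refl
    swap-middle false true  false e = ≡.refl
    swap-middle false false c     e = ≡.refl

  shareVertex-refl : ∀ (e : Fin n × Fin n) → shareVertex e e ≡ true
  shareVertex-refl (i , j) rewrite ==-refl i = ≡.refl

  disjointPairs : ℤ
  disjointPairs = pairSum (λ e f → 𝟙 (disjoint e f)) E

  private
    pairSum-twice : ∀ (ψ : Fin n × Fin n → Fin n × Fin n → ℤ) → (∀ e f → ψ e f ≡ ψ f e) → (∀ e → ψ e e ≡ + 0) →
                    + 2 * pairSum ψ E ≡ ∑[ e ∈ E ] ∑[ f ∈ E ] ψ e f
    pairSum-twice ψ ψ-sym ψ-diag = begin
      + 2 * pairSum ψ E                            ≡⟨ twice (pairSum ψ E) ⟩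
      pairSum ψ E + pairSum ψ E + + 0              ≡⟨ ≡.cong (λ z → pairSum ψ E + pairSum ψ E + z) diagonal ⟨
      pairSum ψ E + pairSum ψ E + ∑[ e ∈ E ] ψ e e ≡⟨ pairSum-double ψ ψ-sym E ⟩
      ∑[ e ∈ E ] ∑[ f ∈ E ] ψ e f                  ∎
      where
      twice : ∀ p → + 2 * p ≡ p + p + + 0
      twice = solve-∀
      diagonal : ∑[ e ∈ E ] ψ e e ≡ + 0
      diagonal = ≡.trans (∑-cong ψ-diag E) (∑-zero E)

  disjointPairs-count : + 2 * disjointPairs ≡ (m + + 1) * m - ∑ degreeSum E
  disjointPairs-count = begin
    + 2 * disjointPairs
      ≡⟨ pairSum-twice (λ e f → 𝟙 (disjoint e f)) (λ e f → ≡.cong (𝟙 ∘ not) (shareVertex-sym e f))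
                       (λ e → ≡.cong (𝟙 ∘ not) (shareVertex-refl e)) ⟩
    ∑[ e ∈ E ] ∑[ f ∈ E ] 𝟙 (disjoint e f)
      ≡⟨ ∑-congᴬˡˡ (All.map disjoint-count edges-ordered) ⟩
    ∑[ e ∈ E ] ((m + + 1) - degreeSum e)
      ≡⟨ ∑-distrib-+ (λ _ → m + + 1) (λ e → - degreeSum e) E ⟩
    ∑[ e ∈ E ] (m + + 1) + ∑[ e ∈ E ] (- degreeSum e)
      ≡⟨ ≡.cong₂ _+_ (∑-const (m + + 1) E) (-‿distrib-∑ degreeSum E) ⟩
    (m + + 1) * m - ∑ degreeSum E ∎

  degreePairs : ℤ
  degreePairs = pairSum (λ e f → if disjoint e f then degreeSum e + degreeSum f else + 0) E

  ∑-disjoint-* : ∑[ e ∈ E ] ∑[ f ∈ E ] (𝟙 (disjoint e f) * degreeSum e) ≡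
                 (m + + 1) * ∑ degreeSum E - ∑[ e ∈ E ] (degreeSum e * degreeSum e)
  ∑-disjoint-* = begin
    ∑[ e ∈ E ] ∑[ f ∈ E ] (𝟙 (disjoint e f) * degreeSum e)
      ≡⟨ ∑-congᴬˡˡ (All.map row edges-ordered) ⟩
    ∑[ e ∈ E ] (((m + + 1) - degreeSum e) * degreeSum e)
      ≡⟨ ∑-cong (λ e → distrib (m + + 1) (degreeSum e)) E ⟩
    ∑[ e ∈ E ] ((m + + 1) * degreeSum e - degreeSum e * degreeSum e)
      ≡⟨ ∑-distrib-+ _ _ E ⟩
    ∑[ e ∈ E ] ((m + + 1) * degreeSum e) + ∑[ e ∈ E ] (- (degreeSum e * degreeSum e))
      ≡⟨ ≡.cong₂ _+_ (*-distribˡ-∑ (m + + 1) degreeSum E) (-‿distrib-∑ _ E) ⟩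
    (m + + 1) * ∑ degreeSum E - ∑[ e ∈ E ] (degreeSum e * degreeSum e) ∎
    where
    row : ∀ {e} → IsEdge e → ∑[ f ∈ E ] (𝟙 (disjoint e f) * degreeSum e) ≡ ((m + + 1) - degreeSum e) * degreeSum e
    row {e} e-edge = ≡.trans (*-distribʳ-∑ (degreeSum e) (λ f → 𝟙 (disjoint e f)) E)
                             (≡.cong (_* degreeSum e) (disjoint-count e-edge))
    distrib : ∀ a s → (a - s) * s ≡ a * s - s * s
    distrib = solve-∀

  degreePairs-twice : + 2 * degreePairs ≡ + 2 * ∑[ e ∈ E ] ∑[ f ∈ E ] (𝟙 (disjoint e f) * degreeSum e)
  degreePairs-twice = begin
    + 2 * degreePairs
      ≡⟨ pairSum-twice ψ ψ-sym ψ-diag ⟩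
    ∑[ e ∈ E ] ∑[ f ∈ E ] ψ e f
      ≡⟨ ∑-cong (λ e → ≡.trans (∑-cong (ψ-split e) E) (∑-distrib-+ _ _ E)) E ⟩
    ∑[ e ∈ E ] (∑[ f ∈ E ] (𝟙 (disjoint e f) * degreeSum e) + ∑[ f ∈ E ] (𝟙 (disjoint e f) * degreeSum f))
      ≡⟨ ∑-distrib-+ _ _ E ⟩
    H + ∑[ e ∈ E ] ∑[ f ∈ E ] (𝟙 (disjoint e f) * degreeSum f)
      ≡⟨ ≡.cong (λ z → H + z) (≡.trans (∑-comm _ E E) (∑-cong (λ f → ∑-cong (λ e → swap e f) E) E)) ⟩
    H + H
      ≡⟨ twice H ⟩
    + 2 * H ∎
    where
    H : ℤ
    H = ∑[ e ∈ E ] ∑[ f ∈ E ] (𝟙 (disjoint e f) * degreeSum e)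
    ψ : Fin n × Fin n → Fin n × Fin n → ℤ
    ψ e f = if disjoint e f then degreeSum e + degreeSum f else + 0
    ψ-sym : ∀ e f → ψ e f ≡ ψ f e
    ψ-sym e f = ≡.trans (≡.cong (λ b → if not b then degreeSum e + degreeSum f else + 0) (shareVertex-sym e f))
                        (if-+-comm (disjoint f e) (degreeSum e) (degreeSum f))
      where
      if-+-comm : ∀ b a a′ → (if b then a + a′ else + 0) ≡ (if b then a′ + a else + 0)
      if-+-comm true  a a′ = ℤ.+-comm a a′
      if-+-comm false a a′ = ≡.refl
    ψ-diag : ∀ e → ψ e e ≡ + 0
    ψ-diag e = ≡.cong (λ b → if not b then degreeSum e + degreeSum e else + 0) (shareVertex-refl e)
    ψ-split : ∀ e f → ψ e f ≡ 𝟙 (disjoint e f) * degreeSum e + 𝟙 (disjoint e f) * degreeSum f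
    ψ-split e f = if-+ (disjoint e f) (degreeSum e) (degreeSum f)
      where
      if-+ : ∀ b a a′ → (if b then a + a′ else + 0) ≡ 𝟙 b * a + 𝟙 b * a′
      if-+ true  a a′ = ≡.sym (≡.cong₂ _+_ (ℤ.*-identityˡ a) (ℤ.*-identityˡ a′))
      if-+ false a a′ = ≡.refl
    swap : ∀ e f → 𝟙 (disjoint e f) * degreeSum f ≡ 𝟙 (disjoint f e) * degreeSum f
    swap e f = ≡.cong (λ b → 𝟙 (not b) * degreeSum f) (shareVertex-sym e f)
    twice : ∀ p → p + p ≡ + 2 * p
    twice = solve-∀

  degreePairs-count : degreePairs ≡ (m + + 1) * ∑ degreeSum E - ∑[ e ∈ E ] (degreeSum e * degreeSum e)
  degreePairs-count = ≡.trans (ℤ.*-cancelˡ-≡ (+ 2) degreePairs _ degreePairs-twice) ∑-disjoint-*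

  edgePowerSum : ℕ → ℤ
  edgePowerSum k = ∑[ e ∈ E ] (powR (d (proj₁ e)) k + powR (d (proj₂ e)) k)

  A-stat-∑ : ∀ k → + A-stat G k ≡ ∑[ v ∈ V ] powR (d v) k
  A-stat-∑ k = ≡.trans (+-∑ _ V) (∑-cong (λ v → +-pow (deg G v) k) V)
    where
    +-pow : ∀ x k → + powℕ x k ≡ powR (+ x) k
    +-pow x zero    = ≡.refl
    +-pow x (suc k) = ≡.trans (ℤ.pos-* x (powℕ x k)) (≡.cong (+ x *_) (+-pow x k))

  edgePowerSum≡A-stat : ∀ k → edgePowerSum k ≡ + A-stat G (suc k)
  edgePowerSum≡A-stat k = ≡.trans (handshake (λ v → powR (d v) k)) (≡.sym (A-stat-∑ (suc k)))

  ∑-degreeSum≡A-stat : ∑ degreeSum E ≡ + A-stat G 2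
  ∑-degreeSum≡A-stat = ≡.trans (∑-cong (λ e → as-powers (d (proj₁ e)) (d (proj₂ e))) E) (edgePowerSum≡A-stat 1)
    where
    as-powers : ∀ x y → x + y ≡ x * + 1 + y * + 1
    as-powers = solve-∀

  B-stat-∑ : + B-stat G ≡ ∑[ e ∈ E ] (d (proj₁ e) * d (proj₂ e))
  B-stat-∑ = ≡.trans (+-∑ _ E) (∑-cong (λ e → ℤ.pos-* (deg G (proj₁ e)) (deg G (proj₂ e))) E)

  C-stat-∑ : + C-stat G ≡ ∑[ e ∈ E ] (d (proj₁ e) * d (proj₁ e) * d (proj₂ e) + d (proj₁ e) * d (proj₂ e) * d (proj₂ e))
  C-stat-∑ = ≡.trans (+-∑ _ E) (∑-cong (λ e → +-cterm (deg G (proj₁ e)) (deg G (proj₂ e))) E)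
    where
    +-cterm : ∀ x y → + (x ℕ.* x ℕ.* y ℕ.+ x ℕ.* y ℕ.* y) ≡ + x * + x * + y + + x * + y * + y
    +-cterm x y = ≡.trans (ℤ.pos-+ (x ℕ.* x ℕ.* y) (x ℕ.* y ℕ.* y))
      (≡.cong₂ _+_ (≡.trans (ℤ.pos-* (x ℕ.* x) y) (≡.cong (_* + y) (ℤ.pos-* x x)))
                   (≡.trans (ℤ.pos-* (x ℕ.* y) y) (≡.cong (_* + y) (ℤ.pos-* x y))))

  ∑-degreeSum² : ∑[ e ∈ E ] (degreeSum e * degreeSum e) ≡ edgePowerSum 2 + + 2 * ∑[ e ∈ E ] (d (proj₁ e) * d (proj₂ e))
  ∑-degreeSum² = begin
    ∑[ e ∈ E ] (degreeSum e * degreeSum e)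
      ≡⟨ ∑-cong (λ e → square (d (proj₁ e)) (d (proj₂ e))) E ⟩
    ∑[ e ∈ E ] ((powR (d (proj₁ e)) 2 + powR (d (proj₂ e)) 2) + + 2 * (d (proj₁ e) * d (proj₂ e)))
      ≡⟨ ∑-distrib-+ _ _ E ⟩
    edgePowerSum 2 + ∑[ e ∈ E ] (+ 2 * (d (proj₁ e) * d (proj₂ e)))
      ≡⟨ ≡.cong (λ z → edgePowerSum 2 + z) (*-distribˡ-∑ (+ 2) (λ e → d (proj₁ e) * d (proj₂ e)) E) ⟩
    edgePowerSum 2 + + 2 * ∑[ e ∈ E ] (d (proj₁ e) * d (proj₂ e)) ∎
    where
    square : ∀ x y → (x + y) * (x + y) ≡ (x * (x * + 1) + y * (y * + 1)) + + 2 * (x * y)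
    square = solve-∀

module MatchingExpansion {n : ℕ} (G : Graph n) where
  open SeriesRing ℤ-ring
  open Syntax
  open Reversal ℤ-ring
  open SublistSums ℤ-ring
  open ListSums seriesRing
  open EdgeFacts G
  open DegreeCounting G using (V; E; d; 𝟙; disjoint; degreeSum)
  private
    module ℤ∑ = ListSums ℤ-ring
  open import Relation.Binary.Reasoning.Setoid (CommutativeRing.setoid seriesRing)

  Edge : Set
  Edge = Fin n × Fin n

  φ : ℤ → Series ℤ
  φ x = t *ₛ geometric x

  vertexFactor : List Edge → Fin n → Series ℤ
  vertexFactor M v = if covered M v then φ (d v) else 1ₛ

  edgeWeight : Edge → Series ℤ
  edgeWeight (x , y) = -ₛ (φ (d x) *ₛ φ (d y))

  degreeProduct : Series ℤ
  degreeProduct = ∏[ v ∈ V ] linear (d v)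

  sign : List Edge → ℤ
  sign M = signℤ (List.length M)

  linear-*-φ : ∀ x → linear x *ₛ φ x ≈ₛ t
  linear-*-φ x = proveₛ [] (x ∷ []) (λ where
    [] (X ∷ []) → :linear X :*ₛ (:t :*ₛ :geometric X) , :t) ≡.refl

  uncovered-factor : ∀ M v → (if not (covered M v) then linear (d v) else t) ≈ₛ linear (d v) *ₛ vertexFactor M v
  uncovered-factor M v with covered M v
  ... | true  = ≈ₛ-sym (linear-*-φ (d v))
  ... | false = ≈ₛ-sym (*ₛ-identityʳ _)

  reversed-LM : reversed n (laplacianMatchingPoly G) ≈ₛ
                degreeProduct *ₛ ∑[ M ∈ matchings G ] (sign M ·ₛ ∏[ v ∈ V ] vertexFactor M v)
  reversed-LM = begin
    reversed n (laplacianMatchingPoly G)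
      ≈⟨ reversed-∑ n _ (matchings G) ⟩
    ∑[ M ∈ matchings G ] reversed n (InRing.scaleR ℤ-ring (sign M) (linearProduct (not ∘ covered M) d V))
      ≈⟨ ∑-cong term (matchings G) ⟩
    ∑[ M ∈ matchings G ] (degreeProduct *ₛ (sign M ·ₛ ∏[ v ∈ V ] vertexFactor M v))
      ≈⟨ *-distribˡ-∑ degreeProduct _ (matchings G) ⟩
    degreeProduct *ₛ ∑[ M ∈ matchings G ] (sign M ·ₛ ∏[ v ∈ V ] vertexFactor M v) ∎
    where
    term : ∀ M → reversed n (InRing.scaleR ℤ-ring (sign M) (linearProduct (not ∘ covered M) d V)) ≈ₛ
                 degreeProduct *ₛ (sign M ·ₛ ∏[ v ∈ V ] vertexFactor M v)
    term M = begin
      reversed n (InRing.scaleR ℤ-ring (sign M) (linearProduct (not ∘ covered M) d V))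
        ≈⟨ reversed-scaleR n (sign M) (linearProduct (not ∘ covered M) d V) ⟩
      sign M ·ₛ reversed n (linearProduct (not ∘ covered M) d V)
        ≈⟨ ·ₛ-congʳ (sign M) (reversed-linearProduct-allFin (not ∘ covered M) d) ⟩
      sign M ·ₛ ∏[ v ∈ V ] (if not (covered M v) then linear (d v) else t)
        ≈⟨ ·ₛ-congʳ (sign M) (∏-cong (uncovered-factor M) V) ⟩
      sign M ·ₛ ∏[ v ∈ V ] (linear (d v) *ₛ vertexFactor M v)
        ≈⟨ ·ₛ-congʳ (sign M) (∏-distrib-* (linear ∘ d) (vertexFactor M) V) ⟩
      sign M ·ₛ (degreeProduct *ₛ ∏[ v ∈ V ] vertexFactor M v)
        ≈⟨ ·ₛ-*ₛ (sign M) degreeProduct (∏[ v ∈ V ] vertexFactor M v) ⟩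
      degreeProduct *ₛ (sign M ·ₛ ∏[ v ∈ V ] vertexFactor M v) ∎

  private
    ∧-true : ∀ {a b} → a ∧ b ≡ true → a ≡ true × b ≡ true
    ∧-true {true} {true} _ = ≡.refl , ≡.refl

    nor₄ : ∀ a b c e → not (a ∨ b ∨ c ∨ e) ≡ true → (a ≡ false × b ≡ false) × (c ≡ false × e ≡ false)
    nor₄ false false false false _ = (≡.refl , ≡.refl) , (≡.refl , ≡.refl)

    if-∨ : ∀ a b c (X : Series ℤ) → (a ≡ true → b ≡ false) → (a ≡ true → c ≡ false) → (b ≡ true → c ≡ false) →
           (if (a ∨ b) ∨ c then X else 1ₛ) ≈ₛ (if a then X else 1ₛ) *ₛ ((if b then X else 1ₛ) *ₛ (if c then X else 1ₛ))
    if-∨ true  true  c     X a⇒¬b _ _ with () ← a⇒¬b ≡.refl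
    if-∨ true  false true  X _ a⇒¬c _ with () ← a⇒¬c ≡.refl
    if-∨ false true  true  X _ _ b⇒¬c with () ← b⇒¬c ≡.refl
    if-∨ true  false false X _ _ _ = ≈ₛ-sym (≈ₛ-trans (*ₛ-cong (≈ₛ-refl {X}) (*ₛ-identityʳ 1ₛ)) (*ₛ-identityʳ X))
    if-∨ false true  false X _ _ _ = ≈ₛ-sym (≈ₛ-trans (*ₛ-identityˡ (X *ₛ 1ₛ)) (*ₛ-identityʳ X))
    if-∨ false false true  X _ _ _ = ≈ₛ-sym (≈ₛ-trans (*ₛ-identityˡ (1ₛ *ₛ X)) (*ₛ-identityˡ X))
    if-∨ false false false X _ _ _ = ≈ₛ-sym (≈ₛ-trans (*ₛ-identityˡ (1ₛ *ₛ 1ₛ)) (*ₛ-identityˡ 1ₛ))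

    sign-step : ∀ k x y z → (ℤ.- k) ·ₛ (x *ₛ (y *ₛ z)) ≈ₛ (-ₛ (x *ₛ y)) *ₛ (k ·ₛ z)
    sign-step k x y z = proveₛ (x ∷ y ∷ z ∷ []) (k ∷ []) (λ where
      (X ∷ Y ∷ Z ∷ []) (K ∷ []) → (:- K) :·ₛ (X :*ₛ (Y :*ₛ Z)) , (:-ₛ (X :*ₛ Y)) :*ₛ (K :·ₛ Z)) ≡.refl

  disjoint-uncovered : ∀ (M : List Edge) (x y : Fin n) → all (λ f → not (shareVertex (x , y) f)) M ≡ true →
                       covered M x ≡ false × covered M y ≡ false
  disjoint-uncovered []            x y _ = ≡.refl , ≡.refl
  disjoint-uncovered ((i , j) ∷ M) x y disjoint
    with nor₄ (x == i) (x == j) (y == i) (y == j) (proj₁ (∧-true disjoint))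
       | disjoint-uncovered M x y (proj₂ (∧-true disjoint))
  ... | (x≠i , x≠j) , (y≠i , y≠j) | uncovered-x , uncovered-y =
    ≡.trans (≡.cong₂ (λ a b → (a ∨ b) ∨ covered M x) x≠i x≠j) uncovered-x ,
    ≡.trans (≡.cong₂ (λ a b → (a ∨ b) ∨ covered M y) y≠i y≠j) uncovered-y

  matching-term : ∀ (M : List Edge) → isMatching M ≡ true → All IsEdge M →
                  sign M ·ₛ ∏[ v ∈ V ] vertexFactor M v ≈ₛ ∏[ e ∈ M ] edgeWeight e
  matching-term [] _ _ = ≈ₛ-trans (·ₛ-congʳ (+ 1) (∏-1 V)) (≈-series ≡.refl ≡.refl ≡.refl ≡.refl ≡.refl ≡.refl)
  matching-term ((x , y) ∷ M) matching (xy ∷ M-edges) = begin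
    ℤ.- sign M ·ₛ ∏[ v ∈ V ] vertexFactor ((x , y) ∷ M) v
      ≈⟨ ·ₛ-congʳ (ℤ.- sign M) (∏-cong split V) ⟩
    ℤ.- sign M ·ₛ ∏[ v ∈ V ] (at x v *ₛ (at y v *ₛ vertexFactor M v))
      ≈⟨ ·ₛ-congʳ (ℤ.- sign M) (≈ₛ-trans (∏-distrib-* (at x) _ V)
                                         (*ₛ-cong (∏-δ x (φ ∘ d)) (∏-distrib-* (at y) (vertexFactor M) V))) ⟩
    ℤ.- sign M ·ₛ (φ (d x) *ₛ (∏[ v ∈ V ] at y v *ₛ P))
      ≈⟨ ·ₛ-congʳ (ℤ.- sign M) (*ₛ-cong (≈ₛ-refl {φ (d x)}) (*ₛ-cong (∏-δ y (φ ∘ d)) (≈ₛ-refl {P}))) ⟩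
    ℤ.- sign M ·ₛ (φ (d x) *ₛ (φ (d y) *ₛ P))
      ≈⟨ sign-step (sign M) (φ (d x)) (φ (d y)) P ⟩
    edgeWeight (x , y) *ₛ (sign M ·ₛ P)
      ≈⟨ *ₛ-cong (≈ₛ-refl {edgeWeight (x , y)}) (matching-term M (proj₂ (∧-true matching)) M-edges) ⟩
    edgeWeight (x , y) *ₛ ∏[ e ∈ M ] edgeWeight e ∎
    where
    P : Series ℤ
    P = ∏[ v ∈ V ] vertexFactor M v
    at : Fin n → Fin n → Series ℤ
    at z v = if v == z then φ (d v) else 1ₛ
    uncovered : covered M x ≡ false × covered M y ≡ false
    uncovered = disjoint-uncovered M x y (proj₁ (∧-true matching))
    split : ∀ v → vertexFactor ((x , y) ∷ M) v ≈ₛ at x v *ₛ (at y v *ₛ vertexFactor M v)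
    split v = if-∨ (v == x) (v == y) (covered M v) (φ (d v)) x⇒¬y (λ v=x → uncovered-at (proj₁ uncovered) v=x)
                                                                (λ v=y → uncovered-at (proj₂ uncovered) v=y)
      where
      x⇒¬y : (v == x) ≡ true → (v == y) ≡ false
      x⇒¬y v=x with v == y in v=y
      ... | true  = contradiction (≡.trans (≡.sym (==⇒≡ v=x)) (==⇒≡ v=y)) (edge-distinct xy)
      ... | false = ≡.refl
      uncovered-at : ∀ {z} → covered M z ≡ false → (v == z) ≡ true → covered M v ≡ false
      uncovered-at {z} uncovered-z v=z = ≡.subst (λ u → covered M u ≡ false) (≡.sym (==⇒≡ v=z)) uncovered-z

  edgeWeight-coefficients : ∀ x y → -ₛ (φ x *ₛ φ y) ≈ₛ
    series (+ 0) (+ 0) (ℤ.- + 1) (ℤ.- (x ℤ.+ y)) (ℤ.- (x ℤ.* x ℤ.+ x ℤ.* y ℤ.+ y ℤ.* y))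
           (ℤ.- (x ℤ.* x ℤ.* x ℤ.+ x ℤ.* x ℤ.* y ℤ.+ x ℤ.* y ℤ.* y ℤ.+ y ℤ.* y ℤ.* y))
  edgeWeight-coefficients x y = proveₛ [] (x ∷ y ∷ []) (λ where
    [] (X ∷ Y ∷ []) → :-ₛ ((:t :*ₛ :geometric X) :*ₛ (:t :*ₛ :geometric Y)) ,
                      series (con (+ 0)) (con (+ 0)) (:- con (+ 1)) (:- (X :+ Y)) (:- (X :* X :+ X :* Y :+ Y :* Y))
                             (:- (X :* X :* X :+ X :* X :* Y :+ X :* Y :* Y :+ Y :* Y :* Y)))
    ≡.refl

  edgeWeight-product : ∀ x y u v → -ₛ (φ x *ₛ φ y) *ₛ -ₛ (φ u *ₛ φ v) ≈ₛ
    series (+ 0) (+ 0) (+ 0) (+ 0) (+ 1) ((x ℤ.+ y) ℤ.+ (u ℤ.+ v))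
  edgeWeight-product x y u v = proveₛ [] (x ∷ y ∷ u ∷ v ∷ []) (λ where
    [] (X ∷ Y ∷ U ∷ W ∷ []) → :-ₛ ((:t :*ₛ :geometric X) :*ₛ (:t :*ₛ :geometric Y)) :*ₛ
                              :-ₛ ((:t :*ₛ :geometric U) :*ₛ (:t :*ₛ :geometric W)) ,
                              series (con (+ 0)) (con (+ 0)) (con (+ 0)) (con (+ 0)) (con (+ 1)) ((X :+ Y) :+ (U :+ W)))
    ≡.refl

  t²∣edgeWeight : ∀ e → t²∣ edgeWeight e
  t²∣edgeWeight (x , y) = ≈₀ (edgeWeight-coefficients (d x) (d y)) , ≈₁ (edgeWeight-coefficients (d x) (d y))

  matchings-sum : ∑[ M ∈ matchings G ] (sign M ·ₛ ∏[ v ∈ V ] vertexFactor M v) ≈ₛ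
                  sublistSum edgeWeight t²∣edgeWeight isMatching E
  matchings-sum = ≈ₛ-trans (∑-filterᵇ isMatching _ (sublists E)) (∑-congᴬˡˡ (All.map term (All-sublists edges-ordered)))
    where
    term : ∀ {M} → All IsEdge M → (if isMatching M then sign M ·ₛ ∏[ v ∈ V ] vertexFactor M v else 0ₛ) ≈ₛ
                                    (if isMatching M then ∏[ e ∈ M ] edgeWeight e else 0ₛ)
    term {M} M-edges with isMatching M in matching
    ... | true  = matching-term M matching M-edges
    ... | false = ≈ₛ-refl

  reversed-LM-expansion : reversed n (laplacianMatchingPoly G) ≈ₛ
    degreeProduct *ₛ (1ₛ +ₛ ∑[ e ∈ E ] edgeWeight e +ₛ quadraticTerms edgeWeight t²∣edgeWeight isMatching E)
  reversed-LM-expansion = ≈ₛ-trans reversed-LM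
    (*ₛ-cong (≈ₛ-refl {degreeProduct}) (≈ₛ-trans matchings-sum (sublistSum-expansion edgeWeight t²∣edgeWeight isMatching E)))

  private
    isMatching-pair : ∀ e f → isMatching (e ∷ f ∷ []) ≡ disjoint e f
    isMatching-pair e f = ≡.trans (Bool.∧-identityʳ (disjoint e f ∧ true)) (Bool.∧-identityʳ (disjoint e f))

    pair-term : ∀ e f → (if isMatching (e ∷ f ∷ []) then edgeWeight e *ₛ edgeWeight f else 0ₛ) ≈ₛ
                        series (+ 0) (+ 0) (+ 0) (+ 0) (𝟙 (disjoint e f))
                               (if disjoint e f then degreeSum e ℤ.+ degreeSum f else + 0)
    pair-term e f = ≡.subst (λ b → (if b then W else 0ₛ) ≈ₛ target (disjoint e f)) (≡.sym (isMatching-pair e f))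
                            (by-cases (disjoint e f))
      where
      W : Series ℤ
      W = edgeWeight e *ₛ edgeWeight f
      target : Bool → Series ℤ
      target b = series (+ 0) (+ 0) (+ 0) (+ 0) (𝟙 b) (if b then degreeSum e ℤ.+ degreeSum f else + 0)
      by-cases : ∀ b → (if b then W else 0ₛ) ≈ₛ target b
      by-cases true  = edgeWeight-product (d (proj₁ e)) (d (proj₂ e)) (d (proj₁ f)) (d (proj₂ f))
      by-cases false = ≈ₛ-refl

  quadraticTerms-coefficients : ∀ L → quadraticTerms edgeWeight t²∣edgeWeight isMatching L ≈ₛ
    series (+ 0) (+ 0) (+ 0) (+ 0) (ℤ∑.pairSum (λ e f → 𝟙 (disjoint e f)) L)
           (ℤ∑.pairSum (λ e f → if disjoint e f then degreeSum e ℤ.+ degreeSum f else + 0) L)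
  quadraticTerms-coefficients []      = ≈ₛ-refl
  quadraticTerms-coefficients (e ∷ L) = ≈ₛ-trans
    (+ₛ-cong (≈ₛ-trans (∑-cong (pair-term e) L) (∑ₛ-coefficients _ L)) (quadraticTerms-coefficients L))
    (≈-series vanishes vanishes vanishes vanishes ≡.refl ≡.refl)
    where
    vanishes : ℤ∑.∑ (λ _ → + 0) L ℤ.+ + 0 ≡ + 0
    vanishes = ≡.trans (ℤ.+-identityʳ _) (ℤ∑.∑-zero L)

module LaplacianMatchingPowerSums {n : ℕ} (G : Graph n) where
  open SeriesRing ℤ-ring
  open PowerSums ℤ-ring
  open Reversal ℤ-ring using (reversed)
  open SublistSums ℤ-ring using (∑ₛ-coefficients)
  open DegreeCounting G
  open MatchingExpansion G
    using (edgeWeight; edgeWeight-coefficients; degreeProduct; reversed-LM-expansion; quadraticTerms-coefficients)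
  open ListSums ℤ-ring
  open InRing ℤ-ring using (powR)
  open import Data.Integer using (_+_; _*_; _-_; -_)
  open import Data.Integer.Tactic.RingSolver using (solve-∀)
  open ≡.≡-Reasoning
  private
    module 𝕊 = ListSums seriesRing

  B′ C′ : ℤ
  B′ = ∑[ e ∈ E ] (d (proj₁ e) * d (proj₂ e))
  C′ = ∑[ e ∈ E ] (d (proj₁ e) * d (proj₁ e) * d (proj₂ e) + d (proj₁ e) * d (proj₂ e) * d (proj₂ e))

  -- 1 + Σₑ wₑ + Σ_{disjoint e, f} wₑ w_f, coefficient by coefficient
  remainder : Series ℤ
  remainder = 1ₛ +ₛ series (+ 0) (+ 0) (- m) (- ∑ degreeSum E) (- (edgePowerSum 2 + B′)) (- (edgePowerSum 3 + C′))
                 +ₛ series (+ 0) (+ 0) (+ 0) (+ 0) disjointPairs degreePairs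

  edgeWeights-coefficients : 𝕊.∑ edgeWeight E ≈ₛ
    series (+ 0) (+ 0) (- m) (- ∑ degreeSum E) (- (edgePowerSum 2 + B′)) (- (edgePowerSum 3 + C′))
  edgeWeights-coefficients = ≈ₛ-trans (𝕊.∑-cong (λ e → edgeWeight-coefficients (d (proj₁ e)) (d (proj₂ e))) E)
    (≈ₛ-trans (∑ₛ-coefficients w E) (≈-series (∑-zero E) (∑-zero E) count (-‿distrib-∑ degreeSum E) quadratic cubic))
    where
    w : Fin n × Fin n → Series ℤ
    w (x , y) = series (+ 0) (+ 0) (- + 1) (- (d x + d y)) (- (d x * d x + d x * d y + d y * d y))
                       (- (d x * d x * d x + d x * d x * d y + d x * d y * d y + d y * d y * d y))
    count : ∑[ e ∈ E ] (- + 1) ≡ - m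
    count = ≡.trans (∑-const (- + 1) E) (-1* m)
      where
      -1* : ∀ m → (- + 1) * m ≡ - m
      -1* = solve-∀
    quadratic : ∑[ e ∈ E ] (- (d (proj₁ e) * d (proj₁ e) + d (proj₁ e) * d (proj₂ e) + d (proj₂ e) * d (proj₂ e))) ≡
                - (edgePowerSum 2 + B′)
    quadratic = ≡.trans (-‿distrib-∑ _ E)
      (≡.cong -_ (≡.trans (∑-cong (λ e → split (d (proj₁ e)) (d (proj₂ e))) E) (∑-distrib-+ _ _ E)))
      where
      split : ∀ x y → x * x + x * y + y * y ≡ (x * (x * + 1) + y * (y * + 1)) + x * y
      split = solve-∀
    cubic : ∑[ e ∈ E ] (- (d (proj₁ e) * d (proj₁ e) * d (proj₁ e) + d (proj₁ e) * d (proj₁ e) * d (proj₂ e)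
                          + d (proj₁ e) * d (proj₂ e) * d (proj₂ e) + d (proj₂ e) * d (proj₂ e) * d (proj₂ e))) ≡
            - (edgePowerSum 3 + C′)
    cubic = ≡.trans (-‿distrib-∑ _ E)
      (≡.cong -_ (≡.trans (∑-cong (λ e → split (d (proj₁ e)) (d (proj₂ e))) E) (∑-distrib-+ _ _ E)))
      where
      split : ∀ x y → x * x * x + x * x * y + x * y * y + y * y * y ≡
                      (x * (x * (x * + 1)) + y * (y * (y * + 1))) + (x * x * y + x * y * y)
      split = solve-∀

  reversed-LM-factorisation : reversed n (laplacianMatchingPoly G) ≈ₛ degreeProduct *ₛ remainder
  reversed-LM-factorisation = ≈ₛ-trans reversed-LM-expansion (*ₛ-cong (≈ₛ-refl {degreeProduct})
    (+ₛ-cong (+ₛ-cong (≈ₛ-refl {1ₛ}) edgeWeights-coefficients) (quadraticTerms-coefficients E)))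

  newton-split : ∀ (N : Series ℤ → ℤ) → (∀ {x y} → x ≈ₛ y → N x ≡ N y) →
                 (∀ x y → N (leading1 x *ₛ leading1 y) ≡ N x + N y) →
                 N (reversed n (laplacianMatchingPoly G)) ≡ N degreeProduct + N remainder
  newton-split N N-cong N-* = begin
    N (reversed n (laplacianMatchingPoly G))
      ≡⟨ N-cong reversed-LM-factorisation ⟩
    N (degreeProduct *ₛ remainder)
      ≡⟨ N-cong (*ₛ-cong (≈-leading1 {degreeProduct} (∏-linear-s₀ d V)) (≈-leading1 {remainder} ≡.refl)) ⟩
    N (leading1 degreeProduct *ₛ leading1 remainder)
      ≡⟨ N-* degreeProduct remainder ⟩
    N degreeProduct + N remainder ∎

  private
    arithmetic₄ : ∀ {σ₄ σ₃ s₁ b′ p} a₄ a₃ a₂ b m → σ₄ ≡ a₄ → σ₃ ≡ a₃ → s₁ ≡ a₂ → b′ ≡ b →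
                  + 2 * p ≡ (m + + 1) * m - s₁ →
                  σ₄ + (+ 2 * (- m * - m) - + 4 * (- (σ₃ + b′) + p)) ≡ a₄ + + 4 * a₃ + + 2 * a₂ + + 4 * b - + 2 * m
    arithmetic₄ {p = p} a₄ a₃ a₂ b m ≡.refl ≡.refl ≡.refl ≡.refl 2p≡ =
      ≡.trans (expand a₄ a₃ b m p) (≡.trans (≡.cong (λ z → a₄ + + 2 * (m * m) + + 4 * a₃ + + 4 * b - + 2 * z) 2p≡)
                                            (collect a₄ a₃ a₂ b m))
      where
      expand : ∀ a₄ a₃ b m p → a₄ + (+ 2 * (- m * - m) - + 4 * (- (a₃ + b) + p)) ≡
                               a₄ + + 2 * (m * m) + + 4 * a₃ + + 4 * b - + 2 * (+ 2 * p)
      expand = solve-∀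
      collect : ∀ a₄ a₃ a₂ b m → a₄ + + 2 * (m * m) + + 4 * a₃ + + 4 * b - + 2 * ((m + + 1) * m - a₂) ≡
                                  a₄ + + 4 * a₃ + + 2 * a₂ + + 4 * b - + 2 * m
      collect = solve-∀

    arithmetic₅ : ∀ {σ₅ σ₄ σ₃ s₁ b′ c′ p} a₅ a₄ a₃ a₂ b c m → σ₅ ≡ a₅ → σ₄ ≡ a₄ → σ₃ ≡ a₃ → s₁ ≡ a₂ → b′ ≡ b → c′ ≡ c →
                  p ≡ (m + + 1) * s₁ - (σ₃ + + 2 * b′) →
                  σ₅ + (+ 5 * (- m * - s₁) - + 5 * (- (σ₄ + c′) + p)) ≡
                  a₅ + + 5 * a₄ + + 5 * a₃ - + 5 * a₂ + + 5 * c + + 10 * b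
    arithmetic₅ a₅ a₄ a₃ a₂ b c m ≡.refl ≡.refl ≡.refl ≡.refl ≡.refl ≡.refl ≡.refl = collect a₅ a₄ a₃ a₂ b c m
      where
      collect : ∀ a₅ a₄ a₃ a₂ b c m →
                a₅ + (+ 5 * (- m * - a₂) - + 5 * (- (a₄ + c) + ((m + + 1) * a₂ - (a₃ + + 2 * b)))) ≡
                a₅ + + 5 * a₄ + + 5 * a₃ - + 5 * a₂ + + 5 * c + + 10 * b
      collect = solve-∀

  newton₄-LM : newton₄ (reversed n (laplacianMatchingPoly G)) ≡
    + A-stat G 4 + + 4 * + A-stat G 3 + + 2 * + A-stat G 2 + + 4 * + B-stat G - + 2 * m
  newton₄-LM = begin
    newton₄ (reversed n (laplacianMatchingPoly G))
      ≡⟨ newton-split newton₄ newton₄-cong newton₄-* ⟩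
    newton₄ degreeProduct + newton₄ remainder
      ≡⟨ ≡.cong₂ _+_ (newton₄-∏-linear d V) (newton₄-remainder (- m) (- ∑ degreeSum E) (- (edgePowerSum 2 + B′))
                                                                (- (edgePowerSum 3 + C′)) disjointPairs degreePairs) ⟩
    ∑[ v ∈ V ] powR (d v) 4 + (+ 2 * (- m * - m) - + 4 * (- (edgePowerSum 2 + B′) + disjointPairs))
      ≡⟨ arithmetic₄ (+ A-stat G 4) (+ A-stat G 3) (+ A-stat G 2) (+ B-stat G) m
           (≡.sym (A-stat-∑ 4)) (edgePowerSum≡A-stat 2) ∑-degreeSum≡A-stat (≡.sym B-stat-∑) disjointPairs-count ⟩
    + A-stat G 4 + + 4 * + A-stat G 3 + + 2 * + A-stat G 2 + + 4 * + B-stat G - + 2 * m ∎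

  newton₅-LM : newton₅ (reversed n (laplacianMatchingPoly G)) ≡
    + A-stat G 5 + + 5 * + A-stat G 4 + + 5 * + A-stat G 3 - + 5 * + A-stat G 2 + + 5 * + C-stat G + + 10 * + B-stat G
  newton₅-LM = begin
    newton₅ (reversed n (laplacianMatchingPoly G))
      ≡⟨ newton-split newton₅ newton₅-cong newton₅-* ⟩
    newton₅ degreeProduct + newton₅ remainder
      ≡⟨ ≡.cong₂ _+_ (newton₅-∏-linear d V) (newton₅-remainder (- m) (- ∑ degreeSum E) (- (edgePowerSum 2 + B′))
                                                                (- (edgePowerSum 3 + C′)) disjointPairs degreePairs) ⟩
    ∑[ v ∈ V ] powR (d v) 5 + (+ 5 * (- m * - ∑ degreeSum E) - + 5 * (- (edgePowerSum 3 + C′) + degreePairs))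
      ≡⟨ arithmetic₅ (+ A-stat G 5) (+ A-stat G 4) (+ A-stat G 3) (+ A-stat G 2) (+ B-stat G) (+ C-stat G) m
           (≡.sym (A-stat-∑ 5)) (edgePowerSum≡A-stat 3) (edgePowerSum≡A-stat 2) ∑-degreeSum≡A-stat
           (≡.sym B-stat-∑) (≡.sym C-stat-∑)
           (≡.trans degreePairs-count (≡.cong (λ q → (m + + 1) * ∑ degreeSum E - q) ∑-degreeSum²)) ⟩
    + A-stat G 5 + + 5 * + A-stat G 4 + + 5 * + A-stat G 3 - + 5 * + A-stat G 2 + + 5 * + C-stat G + + 10 * + B-stat G ∎

open import Data.Integer using (_+_; _-_; _*_)

proposition2p1 : ∀ {c ℓ : Level} (R : CommutativeRing c ℓ) (n : ℕ) (G : Graph n)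
    (λs : Fin n → CommutativeRing.Carrier R) →
    InRing.AreRootsOf R (laplacianMatchingPoly G) λs →
    (CommutativeRing._≈_ R (InRing.powerSum R λs 4)
       (InRing.fromℤ R (+ A-stat G 4 + + 4 * + A-stat G 3 + + 2 * + A-stat G 2
                        + + 4 * + B-stat G - + 2 * + numEdges G)))
    × (CommutativeRing._≈_ R (InRing.powerSum R λs 5)
       (InRing.fromℤ R (+ A-stat G 5 + + 5 * + A-stat G 4 + + 5 * + A-stat G 3
                        - + 5 * + A-stat G 2 + + 5 * + C-stat G + + 10 * + B-stat G)))
proposition2p1 R n G λs roots =
  trans (powerSum₄-roots (laplacianMatchingPoly G) λs roots) (reflexive (≡.cong (InRing.fromℤ R) newton₄-LM)) ,
  trans (powerSum₅-roots (laplacianMatchingPoly G) λs roots) (reflexive (≡.cong (InRing.fromℤ R) newton₅-LM))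
  where
  open CommutativeRing R using (trans; reflexive)
  open Roots R using (powerSum₄-roots; powerSum₅-roots)
  open LaplacianMatchingPowerSums G using (newton₄-LM; newton₅-LM)
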